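{- (One vs. One.) Upper bound: for every $n \ge 1$ and every pair of distinct $n$-bit strings $w \neq w'$, there is a first-order $\tau_{\mathsf{string}}$-sentence $\varphi_{w,w'}$ with at most $\log(n)+6$ quantifiers that is true in $\mathbf{B}_w$ and false in $\mathbf{B}_{w'}$; moreover, in prenex form, $\varphi_{w,w'}$ has a quantifier prefix that strictly alternates between $\exists$ and $\forall$ and ends with $\forall$. Lower bound: for all sufficiently large $n$ there exist two $n$-bit strings $w, w'$ such that every first-order $\tau_{\mathsf{string}}$-sentence true in $\mathbf{B}_w$ and false in $\mathbf{B}_{w'}$ has at least $\lfloor \log(n) \rfloor$ quantifiers.
   Context: $\tau_{\mathsf{string}} = \langle <, S; \mathsf{min}, \mathsf{max}\rangle$ with $<$ binary, $S$ unary, $\mathsf{min},\mathsf{max}$ constants. A string $w = w_1\cdots w_n \in \{0,1\}^n$ is encoded by the structure $\mathbf{B}_w$ with universe $\{1,\dots,n\}$, $<$ the usual order, $S = \{i : w_i = 1\}$, $\mathsf{min}=1$, $\mathsf{max}=n$. The number of quantifiers of a sentence is the number of quantifier occurrences. $\log$ is base 2. -}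

module Defs where

open import Data.Nat using (ℕ; zero; suc; _+_; _<_)
open import Data.Fin using (Fin; zero; suc; toℕ; fromℕ)
open import Data.Vec using (Vec; lookup)
open import Data.Bool using (Bool; true)
open import Data.Product using (Σ; _×_)
open import Data.Sum using (_⊎_)
open import Data.Unit using (⊤)
open import Data.Empty using (⊥)
open import Relation.Nullary using (¬_)
open import Relation.Binary.PropositionalEquality using (_≡_)

-- First-order logic over the signature τ_string = ⟨ <, S ; min, max ⟩
-- (with equality).  Variables are de Bruijn indices: Formula k has
-- at most k free variables.

data Term (k : ℕ) : Set where
  var    : Fin k → Term k
  minT   : Term k
  maxT   : Term k

data Formula : ℕ → Set where
  _≐_  : ∀ {k} → Term k → Term k → Formula k
  _≺_  : ∀ {k} → Term k → Term k → Formula k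
  S    : ∀ {k} → Term k → Formula k
  ~_   : ∀ {k} → Formula k → Formula k
  _∧′_ : ∀ {k} → Formula k → Formula k → Formula k
  _∨′_ : ∀ {k} → Formula k → Formula k → Formula k
  _⇒′_ : ∀ {k} → Formula k → Formula k → Formula k
  ∃′   : ∀ {k} → Formula (suc k) → Formula k
  ∀′   : ∀ {k} → Formula (suc k) → Formula k

Sentence : Set
Sentence = Formula 0

quantifiers : ∀ {k} → Formula k → ℕ
quantifiers (t ≐ u)   = 0
quantifiers (t ≺ u)   = 0
quantifiers (S t)     = 0
quantifiers (~ φ)     = quantifiers φ
quantifiers (φ ∧′ ψ)  = quantifiers φ + quantifiers ψ
quantifiers (φ ∨′ ψ)  = quantifiers φ + quantifiers ψ
quantifiers (φ ⇒′ ψ)  = quantifiers φ + quantifiers ψ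
quantifiers (∃′ φ)    = suc (quantifiers φ)
quantifiers (∀′ φ)    = suc (quantifiers φ)

data QF : ∀ {k} → Formula k → Set where
  qf≐ : ∀ {k} {t u : Term k} → QF (t ≐ u)
  qf≺ : ∀ {k} {t u : Term k} → QF (t ≺ u)
  qfS : ∀ {k} {t : Term k} → QF (S t)
  qf~ : ∀ {k} {φ : Formula k} → QF φ → QF (~ φ)
  qf∧ : ∀ {k} {φ ψ : Formula k} → QF φ → QF ψ → QF (φ ∧′ ψ)
  qf∨ : ∀ {k} {φ ψ : Formula k} → QF φ → QF ψ → QF (φ ∨′ ψ)
  qf⇒ : ∀ {k} {φ ψ : Formula k} → QF φ → QF ψ → QF (φ ⇒′ ψ)

mutual
  data AltFromForall : ∀ {k} → Formula k → Set where
    lastForall : ∀ {k} {ψ : Formula (suc k)} → QF ψ → AltFromForall (∀′ ψ)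
    forallThen : ∀ {k} {ψ : Formula (suc k)} → AltFromExists ψ → AltFromForall (∀′ ψ)

  data AltFromExists : ∀ {k} → Formula k → Set where
    existsThen : ∀ {k} {ψ : Formula (suc k)} → AltFromForall ψ → AltFromExists (∃′ ψ)

AlternatingPrenexEndingForall : ∀ {k} → Formula k → Set
AlternatingPrenexEndingForall φ = AltFromForall φ ⊎ AltFromExists φ

-- The structure B_w for w ∈ {0,1}^n, n = suc m ≥ 1:
-- universe Fin (suc m) (element i stands for position i+1),
-- < is the usual order, S = {i : w_i = 1}, min = first, max = last.
-- Assignments: Fin k → Fin (suc m); variable 0 is the most recently bound.

extend : ∀ {n k} → Fin n → (Fin k → Fin n) → Fin (suc k) → Fin n
extend a ρ zero    = a
extend a ρ (suc i) = ρ i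

evalT : ∀ {m k} → (Fin k → Fin (suc m)) → Term k → Fin (suc m)
evalT ρ (var i) = ρ i
evalT ρ minT    = zero
evalT ρ maxT    = fromℕ _

Sat : ∀ {m k} → Vec Bool (suc m) → (Fin k → Fin (suc m)) → Formula k → Set
Sat w ρ (t ≐ u)  = evalT ρ t ≡ evalT ρ u
Sat w ρ (t ≺ u)  = toℕ (evalT ρ t) < toℕ (evalT ρ u)
Sat w ρ (S t)    = lookup w (evalT ρ t) ≡ true
Sat w ρ (~ φ)    = ¬ Sat w ρ φ
Sat w ρ (φ ∧′ ψ) = Sat w ρ φ × Sat w ρ ψ
Sat w ρ (φ ∨′ ψ) = Sat w ρ φ ⊎ Sat w ρ ψ
Sat w ρ (φ ⇒′ ψ) = Sat w ρ φ → Sat w ρ ψ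
Sat w ρ (∃′ φ)   = Σ (Fin _) (λ a → Sat w (extend a ρ) φ)
Sat w ρ (∀′ φ)   = (a : Fin _) → Sat w (extend a ρ) φ

noVars : ∀ {n} → Fin 0 → Fin n
noVars ()

_⊨_ : ∀ {m} → Vec Bool (suc m) → Sentence → Set
w ⊨ φ = Sat w noVars φ

{-# OPTIONS --safe #-}

-- Distinct strings w, w′ differ at some position i, and w is singled out by
-- ∃x. (S x ↔ wᵢ) ∧ x − min ≥ i ∧ max − x ≥ n − 1 − i.  A distance bound t − s ≥ D costs only
-- about log D quantifiers: for s < t it holds iff every x ∈ (s , t] stays out of the middle
-- gap, i.e. x − s ≥ ⌈(D+1)/2⌉ or t − x ≥ ⌊(D+1)/2⌋; and such a disjunction holds iff some point
-- splits one of the two intervals into halves of the required lengths.  Each step halves the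
-- distances and alternates between ∀ and ∃; quantifier-free side conditions are pushed into
-- the matrix, so the prefix alternates strictly.
--
-- With L = ⌊log₂ n⌋ and T = 2 ^ (L − 1), the strings whose only 1 is at position
-- T − 1, respectively T (counting from 0), agree on all sentences with fewer than L
-- quantifiers, by an Ehrenfeucht–Fraïssé argument.  With r rounds to go, Duplicator keeps the
-- distances between corresponding pebbles (min and max included) equal or both at least 2 ^ r,
-- as for plain linear orders; distances to the 1 need only agree up to 2 ^ r − 1, which absorbs
-- the offset between the two 1s, at the price of agreement up to 2 ^ r + 1 for pairs of pebbles
-- on either side of it.

module Submission where

open import Defs
open import Data.Bool using (Bool; true; false)
import Data.Bool.Properties as Bool
open import Data.Empty using (⊥-elim)
open import Data.Fin using (Fin; zero; suc; toℕ; fromℕ<)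
open import Data.Fin.Properties using (toℕ-injective; toℕ-fromℕ; toℕ-fromℕ<; toℕ≤pred[n]; ¬∀⟶∃¬)
open import Data.Nat
  using (ℕ; zero; suc; pred; _+_; _*_; _∸_; _^_; _⊓_; ⌊_/2⌋; ⌈_/2⌉; _≤_; _<_; z≤n; s≤s; _≤?_; _<?_; _≟_; _≡ᵇ_; >-nonZero)
open import Data.Nat.Logarithm using (⌊log₂_⌋; ⌊log₂⌋-mono-≤; ⌊log₂[2^n]⌋≡n; ⌊log₂⌊n/2⌋⌋≡⌊log₂n⌋∸1)
open import Data.Nat.Properties
open import Data.Product using (Σ; ∃; ∃₂; _×_; _,_; proj₁; proj₂; map₂)
open import Data.Sum using (_⊎_; inj₁; inj₂; [_,_]′) renaming (map to ⊎-map)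
open import Data.Vec using (Vec; lookup; tabulate)
open import Data.Vec.Functional using (_∷_; [])
open import Data.Vec.Properties using (tabulate∘lookup; tabulate-cong; lookup∘tabulate)
open import Function using (id; _∘_; _$_)
open import Function.Bundles using (_⇔_; mk⇔; Equivalence)
open import Relation.Binary using (Tri; tri<; tri≈; tri>)
open import Relation.Binary.PropositionalEquality
  using (_≡_; _≢_; refl; sym; trans; cong; cong₂; subst; subst₂; module ≡-Reasoning)
open import Relation.Nullary using (¬_; Dec; yes; no)
open import Relation.Nullary.Decidable using (¬?; _×-dec_; _⊎-dec_)

open Equivalence using (to; from)

private variable
  m k ℓ : ℕ

Assignment : ℕ → ℕ → Set
Assignment m k = Fin k → Fin (suc m)

pos : Assignment m k → Term k → ℕ
pos ρ t = toℕ (evalT ρ t)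

wkTerm : Term k → Term (suc k)
wkTerm (var i) = var (suc i)
wkTerm minT    = minT
wkTerm maxT    = maxT

evalT-wkTerm : (a : Fin (suc m)) (ρ : Assignment m k) (t : Term k) →
               evalT (extend a ρ) (wkTerm t) ≡ evalT ρ t
evalT-wkTerm a ρ (var i) = refl
evalT-wkTerm a ρ minT    = refl
evalT-wkTerm a ρ maxT    = refl

pos-wkTerm : (a : Fin (suc m)) (ρ : Assignment m k) (t : Term k) → pos (extend a ρ) (wkTerm t) ≡ pos ρ t
pos-wkTerm a ρ t = cong toℕ (evalT-wkTerm a ρ t)

v₀ : Term (suc k)
v₀ = var zero

-- Quantifier-free matrices

infix  7 _≤ₘ_ _<ₘ_
infixr 6 _∧ₘ_
infixr 5 _∨ₘ_

data Matrix (k : ℕ) : Set where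
  _≤ₘ_ _<ₘ_ : Term k → Term k → Matrix k
  Sₘ        : Term k → Matrix k
  ⊤ₘ ⊥ₘ     : Matrix k
  _∧ₘ_ _∨ₘ_ : Matrix k → Matrix k → Matrix k
  ¬ₘ_       : Matrix k → Matrix k

⌜_⌝ : Matrix k → Formula k
⌜ t ≤ₘ u ⌝ = ~ (u ≺ t)
⌜ t <ₘ u ⌝ = t ≺ u
⌜ Sₘ t ⌝   = S t
⌜ ⊤ₘ ⌝     = minT ≐ minT
⌜ ⊥ₘ ⌝     = ~ (minT ≐ minT)
⌜ g ∧ₘ h ⌝ = ⌜ g ⌝ ∧′ ⌜ h ⌝
⌜ g ∨ₘ h ⌝ = ⌜ g ⌝ ∨′ ⌜ h ⌝
⌜ ¬ₘ g ⌝   = ~ ⌜ g ⌝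

⌜⌝-QF : (g : Matrix k) → QF ⌜ g ⌝
⌜⌝-QF (t ≤ₘ u) = qf~ qf≺
⌜⌝-QF (t <ₘ u) = qf≺
⌜⌝-QF (Sₘ t)   = qfS
⌜⌝-QF ⊤ₘ       = qf≐
⌜⌝-QF ⊥ₘ       = qf~ qf≐
⌜⌝-QF (g ∧ₘ h) = qf∧ (⌜⌝-QF g) (⌜⌝-QF h)
⌜⌝-QF (g ∨ₘ h) = qf∨ (⌜⌝-QF g) (⌜⌝-QF h)
⌜⌝-QF (¬ₘ g)   = qf~ (⌜⌝-QF g)

wkMatrix : Matrix k → Matrix (suc k)
wkMatrix (t ≤ₘ u) = wkTerm t ≤ₘ wkTerm u
wkMatrix (t <ₘ u) = wkTerm t <ₘ wkTerm u
wkMatrix (Sₘ t)   = Sₘ (wkTerm t)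
wkMatrix ⊤ₘ       = ⊤ₘ
wkMatrix ⊥ₘ       = ⊥ₘ
wkMatrix (g ∧ₘ h) = wkMatrix g ∧ₘ wkMatrix h
wkMatrix (g ∨ₘ h) = wkMatrix g ∨ₘ wkMatrix h
wkMatrix (¬ₘ g)   = ¬ₘ wkMatrix g

litₘ : Bool → Term k → Matrix k
litₘ true  t = Sₘ t
litₘ false t = ¬ₘ Sₘ t

atLeast : ℕ → Term k → Term k → Matrix k
atLeast zero          t u = t ≤ₘ u
atLeast (suc zero)    t u = t <ₘ u
atLeast (suc (suc _)) t u = ⊥ₘ

module _ {m : ℕ} (w : Vec Bool (suc m)) where

  Sat-wkMatrix : (a : Fin (suc m)) (ρ : Assignment m k) (g : Matrix k) →
                 Sat w (extend a ρ) ⌜ wkMatrix g ⌝ ≡ Sat w ρ ⌜ g ⌝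
  Sat-wkMatrix a ρ (t ≤ₘ u) = cong₂ (λ x y → ¬ (x < y)) (pos-wkTerm a ρ u) (pos-wkTerm a ρ t)
  Sat-wkMatrix a ρ (t <ₘ u) = cong₂ _<_ (pos-wkTerm a ρ t) (pos-wkTerm a ρ u)
  Sat-wkMatrix a ρ (Sₘ t)   = cong (λ x → lookup w x ≡ true) (evalT-wkTerm a ρ t)
  Sat-wkMatrix a ρ ⊤ₘ       = refl
  Sat-wkMatrix a ρ ⊥ₘ       = refl
  Sat-wkMatrix a ρ (g ∧ₘ h) = cong₂ _×_ (Sat-wkMatrix a ρ g) (Sat-wkMatrix a ρ h)
  Sat-wkMatrix a ρ (g ∨ₘ h) = cong₂ _⊎_ (Sat-wkMatrix a ρ g) (Sat-wkMatrix a ρ h)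
  Sat-wkMatrix a ρ (¬ₘ g)   = cong ¬_ (Sat-wkMatrix a ρ g)

  weaken-Sat : (a : Fin (suc m)) (ρ : Assignment m k) (g : Matrix k) →
               Sat w ρ ⌜ g ⌝ → Sat w (extend a ρ) ⌜ wkMatrix g ⌝
  weaken-Sat a ρ g = subst id (sym (Sat-wkMatrix a ρ g))

  strengthen-Sat : (a : Fin (suc m)) (ρ : Assignment m k) (g : Matrix k) →
                   Sat w (extend a ρ) ⌜ wkMatrix g ⌝ → Sat w ρ ⌜ g ⌝
  strengthen-Sat a ρ g = subst id (Sat-wkMatrix a ρ g)

  Sat? : (ρ : Assignment m k) (g : Matrix k) → Dec (Sat w ρ ⌜ g ⌝)
  Sat? ρ (t ≤ₘ u) = ¬? (pos ρ u <? pos ρ t)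
  Sat? ρ (t <ₘ u) = pos ρ t <? pos ρ u
  Sat? ρ (Sₘ t)   = lookup w (evalT ρ t) Bool.≟ true
  Sat? ρ ⊤ₘ       = yes refl
  Sat? ρ ⊥ₘ       = no (λ ¬refl → ¬refl refl)
  Sat? ρ (g ∧ₘ h) = Sat? ρ g ×-dec Sat? ρ h
  Sat? ρ (g ∨ₘ h) = Sat? ρ g ⊎-dec Sat? ρ h
  Sat? ρ (¬ₘ g)   = ¬? (Sat? ρ g)

  Sat-≤ₘ : (ρ : Assignment m k) (t u : Term k) → Sat w ρ ⌜ t ≤ₘ u ⌝ ⇔ pos ρ t ≤ pos ρ u
  Sat-≤ₘ ρ t u = mk⇔ ≮⇒≥ ≤⇒≯

  Sat-litₘ : (b : Bool) (ρ : Assignment m k) (t : Term k) → Sat w ρ ⌜ litₘ b t ⌝ ⇔ lookup w (evalT ρ t) ≡ b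
  Sat-litₘ true  ρ t = mk⇔ id id
  Sat-litₘ false ρ t = mk⇔ Bool.¬-not (λ x≡false x≡true → Bool.not-¬ x≡true x≡false)

-- Alternating prenex formulas

data Head : Set where
  ∃ₕ ∀ₕ : Head

data Prenex : Head → ℕ → ℕ → Set where
  matrix : ∀ {h} → Matrix k → Prenex h 0 k
  ∃ₚ     : Prenex ∀ₕ ℓ (suc k) → Prenex ∃ₕ (suc ℓ) k
  ∀ₚ     : Prenex ∃ₕ ℓ (suc k) → Prenex ∀ₕ (suc ℓ) k

⌞_⌟ : ∀ {h} → Prenex h ℓ k → Formula k
⌞ matrix g ⌟ = ⌜ g ⌝
⌞ ∃ₚ φ ⌟     = ∃′ ⌞ φ ⌟
⌞ ∀ₚ φ ⌟     = ∀′ ⌞ φ ⌟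

quantifiers-⌞⌟ : ∀ {h} (φ : Prenex h ℓ k) → quantifiers ⌞ φ ⌟ ≡ ℓ
quantifiers-⌞⌟ (matrix g) = quantifiers-⌜⌝ g
  where
  quantifiers-⌜⌝ : (g : Matrix k) → quantifiers ⌜ g ⌝ ≡ 0
  quantifiers-⌜⌝ (t ≤ₘ u) = refl
  quantifiers-⌜⌝ (t <ₘ u) = refl
  quantifiers-⌜⌝ (Sₘ t)   = refl
  quantifiers-⌜⌝ ⊤ₘ       = refl
  quantifiers-⌜⌝ ⊥ₘ       = refl
  quantifiers-⌜⌝ (g ∧ₘ h) = cong₂ _+_ (quantifiers-⌜⌝ g) (quantifiers-⌜⌝ h)
  quantifiers-⌜⌝ (g ∨ₘ h) = cong₂ _+_ (quantifiers-⌜⌝ g) (quantifiers-⌜⌝ h)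
  quantifiers-⌜⌝ (¬ₘ g)   = quantifiers-⌜⌝ g
quantifiers-⌞⌟ (∃ₚ φ) = cong suc (quantifiers-⌞⌟ φ)
quantifiers-⌞⌟ (∀ₚ φ) = cong suc (quantifiers-⌞⌟ φ)

mutual
  ∀ₚ-alternates : ∀ j (φ : Prenex ∀ₕ (suc (j * 2)) k) → AltFromForall ⌞ φ ⌟
  ∀ₚ-alternates zero    (∀ₚ (matrix g)) = lastForall (⌜⌝-QF g)
  ∀ₚ-alternates (suc j) (∀ₚ φ)          = forallThen (∃ₚ-alternates j φ)

  ∃ₚ-alternates : ∀ j (φ : Prenex ∃ₕ (suc (suc (j * 2))) k) → AltFromExists ⌞ φ ⌟
  ∃ₚ-alternates j (∃ₚ φ) = existsThen (∀ₚ-alternates j φ)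

padded : ∀ h ℓ → Matrix k → Prenex h ℓ k
padded h  zero    g = matrix g
padded ∃ₕ (suc ℓ) g = ∃ₚ (padded ∀ₕ ℓ (wkMatrix g))
padded ∀ₕ (suc ℓ) g = ∀ₚ (padded ∃ₕ ℓ (wkMatrix g))

-- The guard does not mention the variables bound in the prefix, so it can be pushed into the matrix.
ifₚ_then_else_ : ∀ {h} → Matrix k → Prenex h ℓ k → Prenex h ℓ k → Prenex h ℓ k
ifₚ g then matrix a else matrix b = matrix ((g ∧ₘ a) ∨ₘ (¬ₘ g ∧ₘ b))
ifₚ g then ∃ₚ φ     else ∃ₚ ψ     = ∃ₚ (ifₚ wkMatrix g then φ else ψ)
ifₚ g then ∀ₚ φ     else ∀ₚ ψ     = ∀ₚ (ifₚ wkMatrix g then φ else ψ)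

infixr 4 _⇒ₚ_ _∧ₚ_ _∨ₚ_

_⇒ₚ_ _∧ₚ_ _∨ₚ_ : ∀ {h} → Matrix k → Prenex h ℓ k → Prenex h ℓ k
g ⇒ₚ φ = ifₚ g then φ else padded _ _ ⊤ₘ
g ∧ₚ φ = ifₚ g then φ else padded _ _ ⊥ₘ
g ∨ₚ φ = ifₚ g then padded _ _ ⊤ₘ else φ

module _ {m : ℕ} (w : Vec Bool (suc m)) where

  Sat-padded : ∀ h ℓ (ρ : Assignment m k) (g : Matrix k) → Sat w ρ ⌞ padded h ℓ g ⌟ ⇔ Sat w ρ ⌜ g ⌝
  Sat-padded h zero ρ g = mk⇔ id id
  Sat-padded ∃ₕ (suc ℓ) ρ g = mk⇔
    (λ (a , s) → strengthen-Sat w a ρ g (to (Sat-padded ∀ₕ ℓ (extend a ρ) (wkMatrix g)) s))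
    (λ s → zero , from (Sat-padded ∀ₕ ℓ (extend zero ρ) (wkMatrix g)) (weaken-Sat w zero ρ g s))
  Sat-padded ∀ₕ (suc ℓ) ρ g = mk⇔
    (λ s → strengthen-Sat w zero ρ g (to (Sat-padded ∃ₕ ℓ (extend zero ρ) (wkMatrix g)) (s zero)))
    (λ s a → from (Sat-padded ∃ₕ ℓ (extend a ρ) (wkMatrix g)) (weaken-Sat w a ρ g s))

  Sat-ifₚ-then : ∀ {h} (ρ : Assignment m k) (g : Matrix k) (φ ψ : Prenex h ℓ k) → Sat w ρ ⌜ g ⌝ →
                 Sat w ρ ⌞ ifₚ g then φ else ψ ⌟ ⇔ Sat w ρ ⌞ φ ⌟
  Sat-ifₚ-then ρ g (matrix a) (matrix b) G = mk⇔
    (λ { (inj₁ (_ , x)) → x ; (inj₂ (¬G , _)) → ⊥-elim (¬G G) })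
    (λ x → inj₁ (G , x))
  Sat-ifₚ-then ρ g (∃ₚ φ) (∃ₚ ψ) G = mk⇔
    (λ (a , s) → a , to (Sat-ifₚ-then (extend a ρ) (wkMatrix g) φ ψ (weaken-Sat w a ρ g G)) s)
    (λ (a , s) → a , from (Sat-ifₚ-then (extend a ρ) (wkMatrix g) φ ψ (weaken-Sat w a ρ g G)) s)
  Sat-ifₚ-then ρ g (∀ₚ φ) (∀ₚ ψ) G = mk⇔
    (λ s a → to (Sat-ifₚ-then (extend a ρ) (wkMatrix g) φ ψ (weaken-Sat w a ρ g G)) (s a))
    (λ s a → from (Sat-ifₚ-then (extend a ρ) (wkMatrix g) φ ψ (weaken-Sat w a ρ g G)) (s a))

  Sat-ifₚ-else : ∀ {h} (ρ : Assignment m k) (g : Matrix k) (φ ψ : Prenex h ℓ k) → ¬ Sat w ρ ⌜ g ⌝ →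
                 Sat w ρ ⌞ ifₚ g then φ else ψ ⌟ ⇔ Sat w ρ ⌞ ψ ⌟
  Sat-ifₚ-else ρ g (matrix a) (matrix b) ¬G = mk⇔
    (λ { (inj₁ (G , _)) → ⊥-elim (¬G G) ; (inj₂ (_ , x)) → x })
    (λ x → inj₂ (¬G , x))
  Sat-ifₚ-else ρ g (∃ₚ φ) (∃ₚ ψ) ¬G = mk⇔
    (λ (a , s) → a , to (Sat-ifₚ-else (extend a ρ) (wkMatrix g) φ ψ (¬G ∘ strengthen-Sat w a ρ g)) s)
    (λ (a , s) → a , from (Sat-ifₚ-else (extend a ρ) (wkMatrix g) φ ψ (¬G ∘ strengthen-Sat w a ρ g)) s)
  Sat-ifₚ-else ρ g (∀ₚ φ) (∀ₚ ψ) ¬G = mk⇔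
    (λ s a → to (Sat-ifₚ-else (extend a ρ) (wkMatrix g) φ ψ (¬G ∘ strengthen-Sat w a ρ g)) (s a))
    (λ s a → from (Sat-ifₚ-else (extend a ρ) (wkMatrix g) φ ψ (¬G ∘ strengthen-Sat w a ρ g)) (s a))

  Sat-⇒ₚ : ∀ {h} (ρ : Assignment m k) (g : Matrix k) (φ : Prenex h ℓ k) →
           Sat w ρ ⌞ g ⇒ₚ φ ⌟ ⇔ (Sat w ρ ⌜ g ⌝ → Sat w ρ ⌞ φ ⌟)
  Sat-⇒ₚ {ℓ = ℓ} {h = h} ρ g φ = mk⇔ (λ s G → to (Sat-ifₚ-then ρ g φ (padded h ℓ ⊤ₘ) G) s) from′
    where
    from′ : (Sat w ρ ⌜ g ⌝ → Sat w ρ ⌞ φ ⌟) → Sat w ρ ⌞ g ⇒ₚ φ ⌟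
    from′ f with Sat? w ρ g
    ... | yes G = from (Sat-ifₚ-then ρ g φ (padded h ℓ ⊤ₘ) G) (f G)
    ... | no ¬G = from (Sat-ifₚ-else ρ g φ (padded h ℓ ⊤ₘ) ¬G) (from (Sat-padded h ℓ ρ ⊤ₘ) refl)

  Sat-∧ₚ : ∀ {h} (ρ : Assignment m k) (g : Matrix k) (φ : Prenex h ℓ k) →
           Sat w ρ ⌞ g ∧ₚ φ ⌟ ⇔ (Sat w ρ ⌜ g ⌝ × Sat w ρ ⌞ φ ⌟)
  Sat-∧ₚ {ℓ = ℓ} {h = h} ρ g φ = mk⇔ to′ (λ (G , s) → from (Sat-ifₚ-then ρ g φ (padded h ℓ ⊥ₘ) G) s)
    where
    to′ : Sat w ρ ⌞ g ∧ₚ φ ⌟ → Sat w ρ ⌜ g ⌝ × Sat w ρ ⌞ φ ⌟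
    to′ s with Sat? w ρ g
    ... | yes G = G , to (Sat-ifₚ-then ρ g φ (padded h ℓ ⊥ₘ) G) s
    ... | no ¬G = ⊥-elim (to (Sat-padded h ℓ ρ ⊥ₘ) (to (Sat-ifₚ-else ρ g φ (padded h ℓ ⊥ₘ) ¬G) s) refl)

  Sat-∨ₚ : ∀ {h} (ρ : Assignment m k) (g : Matrix k) (φ : Prenex h ℓ k) →
           Sat w ρ ⌞ g ∨ₚ φ ⌟ ⇔ (Sat w ρ ⌜ g ⌝ ⊎ Sat w ρ ⌞ φ ⌟)
  Sat-∨ₚ {ℓ = ℓ} {h = h} ρ g φ = mk⇔ to′ from′
    where
    to′ : Sat w ρ ⌞ g ∨ₚ φ ⌟ → Sat w ρ ⌜ g ⌝ ⊎ Sat w ρ ⌞ φ ⌟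
    to′ s with Sat? w ρ g
    ... | yes G = inj₁ G
    ... | no ¬G = inj₂ (to (Sat-ifₚ-else ρ g (padded h ℓ ⊤ₘ) φ ¬G) s)
    from′ : Sat w ρ ⌜ g ⌝ ⊎ Sat w ρ ⌞ φ ⌟ → Sat w ρ ⌞ g ∨ₚ φ ⌟
    from′ s with Sat? w ρ g | s
    ... | yes G | _      = from (Sat-ifₚ-then ρ g (padded h ℓ ⊤ₘ) φ G) (from (Sat-padded h ℓ ρ ⊤ₘ) refl)
    ... | no ¬G | inj₁ G = ⊥-elim (¬G G)
    ... | no ¬G | inj₂ x = from (Sat-ifₚ-else ρ g (padded h ℓ ⊤ₘ) φ ¬G) x

-- Distance formulas

+-⌊/2⌋+⌈/2⌉ : ∀ P D → P + ⌊ D /2⌋ + ⌈ D /2⌉ ≡ P + D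
+-⌊/2⌋+⌈/2⌉ P D = trans (+-assoc P _ _) (cong (P +_) (⌊n/2⌋+⌈n/2⌉≡n D))

+-⌈/2⌉+⌊/2⌋ : ∀ P D → P + ⌈ D /2⌉ + ⌊ D /2⌋ ≡ P + D
+-⌈/2⌉+⌊/2⌋ P D = trans (+-assoc P _ _) (cong (P +_) (trans (+-comm ⌈ D /2⌉ _) (⌊n/2⌋+⌈n/2⌉≡n D)))

halves-join : ∀ {P X M} D → P + ⌈ D /2⌉ ≤ X → X + ⌊ D /2⌋ ≤ M → P + D ≤ M
halves-join {P} {M = M} D h₁ h₂ = subst (_≤ M) (+-⌈/2⌉+⌊/2⌋ P D) (≤-trans (+-monoˡ-≤ ⌊ D /2⌋ h₁) h₂)

halves-≤ : ∀ {D r} → D ≤ 2 * r → ⌈ D /2⌉ ≤ r × ⌊ D /2⌋ ≤ r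
halves-≤ {D} {r} D≤2r = ⌈D/2⌉≤r , ≤-trans (⌊n/2⌋≤⌈n/2⌉ D) ⌈D/2⌉≤r
  where
  ⌈D/2⌉≤r : ⌈ D /2⌉ ≤ r
  ⌈D/2⌉≤r = subst (⌈ D /2⌉ ≤_) (sym (n≡⌈n+n/2⌉ r)) (⌈n/2⌉-mono (subst (D ≤_) (cong (r +_) (+-identityʳ r)) D≤2r))

-- Note that ⌈ suc D /2⌉ = suc ⌊ D /2⌋ and ⌊ suc D /2⌋ = ⌈ D /2⌉ hold by definition.
outside-gap : ∀ {P M} D X → P + D ≤ M → P + ⌈ suc D /2⌉ ≤ X ⊎ X + ⌊ suc D /2⌋ ≤ M
outside-gap {P} {M} D X P+D≤M with P + ⌈ suc D /2⌉ ≤? X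
... | yes below = inj₁ below
... | no ¬below = inj₂ (≤-trans (+-monoˡ-≤ ⌈ D /2⌉ X≤P+⌊D/2⌋) (subst (_≤ M) (sym (+-⌊/2⌋+⌈/2⌉ P D)) P+D≤M))
  where
  X≤P+⌊D/2⌋ : X ≤ P + ⌊ D /2⌋
  X≤P+⌊D/2⌋ = ≤-pred (subst (suc X ≤_) (+-suc P _) (≰⇒> ¬below))

-- The witness is the point X = min M (P + ⌊ D /2⌋) of the gap.
no-gap : ∀ {P M} D → P + D ⊓ 1 ≤ M →
         (∀ X → P < X → X ≤ M → P + ⌈ suc D /2⌉ ≤ X ⊎ X + ⌊ suc D /2⌋ ≤ M) → P + D ≤ M
no-gap zero             guard _ = guard
no-gap (suc zero)       guard _ = guard
no-gap {P} {M} D@(suc (suc _)) guard outside with P + D ≤? M | P + ⌊ D /2⌋ ≤? M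
... | yes P+D≤M | _         = P+D≤M
... | no  P+D≰M | yes mid≤M = ⊥-elim $
  [ (λ above → 1+n≰n (+-cancelˡ-≤ P _ _ above))
  , (λ below → P+D≰M (subst (_≤ M) (+-⌊/2⌋+⌈/2⌉ P D) below))
  ]′ (outside (P + ⌊ D /2⌋) P<mid mid≤M)
  where
  P<mid : P < P + ⌊ D /2⌋
  P<mid = subst (_≤ P + ⌊ D /2⌋) (+-comm P 1) (+-monoʳ-≤ P (s≤s z≤n))
... | no  _     | no  mid≰M = ⊥-elim $
  [ (λ above → mid≰M (≤-trans (+-monoʳ-≤ P (n≤1+n _)) above))
  , (λ below → m+1+n≰m M below)
  ]′ (outside M (subst (_≤ M) (+-comm P 1) guard) ≤-refl)

orₘ andₘ : ℕ → ℕ → Term k → Term k → Term k → Matrix k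
orₘ  D₁ D₂ s t u = atLeast D₁ s t ∨ₘ atLeast D₂ t u
andₘ D₁ D₂ s t u = atLeast D₁ s t ∧ₘ atLeast D₂ t u

-- farOr ℓ D₁ D₂ s t u says s + D₁ ≤ t or t + D₂ ≤ u, and farAnd says both.  For s < t,
-- s + D ≤ t holds iff no x ∈ (s , t] lies strictly between t ∸ ⌊ suc D /2⌋ and s + ⌈ suc D /2⌉,
-- which is how farAnd reduces to farOr with halved distances.
mutual
  farOr : ∀ ℓ → ℕ → ℕ → Term k → Term k → Term k → Prenex ∃ₕ ℓ k
  farOr zero    D₁ D₂ s t u = matrix (orₘ D₁ D₂ s t u)
  farOr (suc ℓ) D₁ D₂ s t u =
    ∃ₚ (wkMatrix (orₘ D₁ D₂ s t u) ∨ₚ splitAt ℓ D₁ D₂ (wkTerm s) v₀ (wkTerm t) (wkTerm u))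

  splitAt : ∀ ℓ → ℕ → ℕ → Term k → Term k → Term k → Term k → Prenex ∀ₕ ℓ k
  splitAt ℓ D₁ D₂ s x t u =
    ifₚ x ≤ₘ t then farAnd ℓ ⌈ D₁ /2⌉ ⌊ D₁ /2⌋ s x t else farAnd ℓ ⌈ D₂ /2⌉ ⌊ D₂ /2⌋ t x u

  farAnd : ∀ ℓ → ℕ → ℕ → Term k → Term k → Term k → Prenex ∀ₕ ℓ k
  farAnd zero    D₁ D₂ s t u = matrix (andₘ D₁ D₂ s t u)
  farAnd (suc ℓ) D₁ D₂ s t u =
    ∀ₚ (wkMatrix (andₘ (D₁ ⊓ 1) (D₂ ⊓ 1) s t u) ∧ₚ outsideGaps ℓ D₁ D₂ (wkTerm s) v₀ (wkTerm t) (wkTerm u))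

  outsideGaps : ∀ ℓ → ℕ → ℕ → Term k → Term k → Term k → Term k → Prenex ∃ₕ ℓ k
  outsideGaps ℓ D₁ D₂ s x t u =
    ifₚ x ≤ₘ t then (s <ₘ x ⇒ₚ outsideGap ℓ D₁ s x t) else (x ≤ₘ u ⇒ₚ outsideGap ℓ D₂ t x u)

  outsideGap : ∀ ℓ → ℕ → Term k → Term k → Term k → Prenex ∃ₕ ℓ k
  outsideGap ℓ D s x t = farOr ℓ ⌈ suc D /2⌉ ⌊ suc D /2⌋ s x t

mutual
  reach∃ reach∀ : ℕ → ℕ
  reach∃ zero    = 1
  reach∃ (suc ℓ) = 2 * reach∀ ℓ
  reach∀ zero    = 1
  reach∀ (suc ℓ) = pred (2 * reach∃ ℓ)

mutual
  1≤reach∃ : ∀ ℓ → 1 ≤ reach∃ ℓ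
  1≤reach∃ zero    = ≤-refl
  1≤reach∃ (suc ℓ) = ≤-trans (1≤reach∀ ℓ) (m≤m+n _ _)

  1≤reach∀ : ∀ ℓ → 1 ≤ reach∀ ℓ
  1≤reach∀ zero    = ≤-refl
  1≤reach∀ (suc ℓ) = suc[m]≤n⇒m≤pred[n] (*-monoʳ-≤ 2 (1≤reach∃ ℓ))

<reach∀-suc : ∀ ℓ {D} → D ≤ reach∀ (suc ℓ) → suc D ≤ 2 * reach∃ ℓ
<reach∀-suc ℓ = m≤pred[n]⇒suc[m]≤n {{>-nonZero (≤-trans (1≤reach∃ ℓ) (m≤m+n _ _))}}

Far : Assignment m k → ℕ → Term k → Term k → Set
Far ρ D s t = pos ρ s + D ≤ pos ρ t

Far-wkTerm : (a : Fin (suc m)) (ρ : Assignment m k) (D : ℕ) (s t : Term k) →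
             Far (extend a ρ) D (wkTerm s) (wkTerm t) ≡ Far ρ D s t
Far-wkTerm a ρ D s t = cong₂ (λ x y → x + D ≤ y) (pos-wkTerm a ρ s) (pos-wkTerm a ρ t)

weaken-Far : (a : Fin (suc m)) (ρ : Assignment m k) (D : ℕ) (s t : Term k) →
             Far ρ D s t → Far (extend a ρ) D (wkTerm s) (wkTerm t)
weaken-Far a ρ D s t = subst id (sym (Far-wkTerm a ρ D s t))

strengthen-Far : (a : Fin (suc m)) (ρ : Assignment m k) (D : ℕ) (s t : Term k) →
                 Far (extend a ρ) D (wkTerm s) (wkTerm t) → Far ρ D s t
strengthen-Far a ρ D s t = subst id (Far-wkTerm a ρ D s t)

pos≤m : (ρ : Assignment m k) (t : Term k) → pos ρ t ≤ m
pos≤m ρ t = toℕ≤pred[n] (evalT ρ t)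

∀-toℕ : (P : ℕ → Set) → (∀ (a : Fin (suc m)) → P (toℕ a)) → ∀ X → X ≤ m → P X
∀-toℕ P all X X≤m = subst P (toℕ-fromℕ< (s≤s X≤m)) (all (fromℕ< (s≤s X≤m)))

Far-to-v₀ : (a : Fin (suc m)) (ρ : Assignment m k) (D : ℕ) (s : Term k) →
            Far (extend a ρ) D (wkTerm s) v₀ ≡ (pos ρ s + D ≤ toℕ a)
Far-to-v₀ a ρ D s = cong (λ x → x + D ≤ toℕ a) (pos-wkTerm a ρ s)

Far-from-v₀ : (a : Fin (suc m)) (ρ : Assignment m k) (D : ℕ) (t : Term k) →
              Far (extend a ρ) D v₀ (wkTerm t) ≡ (toℕ a + D ≤ pos ρ t)
Far-from-v₀ a ρ D t = cong (toℕ a + D ≤_) (pos-wkTerm a ρ t)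

module _ {m : ℕ} (w : Vec Bool (suc m)) where

  atLeast-sound : ∀ D (ρ : Assignment m k) t u → Sat w ρ ⌜ atLeast D t u ⌝ → Far ρ D t u
  atLeast-sound zero          ρ t u s = subst (_≤ pos ρ u) (sym (+-identityʳ _)) (≮⇒≥ s)
  atLeast-sound (suc zero)    ρ t u s = subst (_≤ pos ρ u) (+-comm 1 _) s
  atLeast-sound (suc (suc D)) ρ t u s = ⊥-elim (s refl)

  atLeast-complete : ∀ D → D ≤ 1 → (ρ : Assignment m k) (t u : Term k) → Far ρ D t u → Sat w ρ ⌜ atLeast D t u ⌝
  atLeast-complete zero           _        ρ t u h = ≤⇒≯ (subst (_≤ pos ρ u) (+-identityʳ _) h)
  atLeast-complete (suc zero)     _        ρ t u h = subst (_≤ pos ρ u) (+-comm _ 1) h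
  atLeast-complete (suc (suc D)) (s≤s ()) ρ t u h

  outsideGaps-left : ∀ ℓ D₁ D₂ (ρ : Assignment m k) s x t u → Sat w ρ ⌞ outsideGaps ℓ D₁ D₂ s x t u ⌟ →
                     pos ρ s < pos ρ x → pos ρ x ≤ pos ρ t → Sat w ρ ⌞ outsideGap ℓ D₁ s x t ⌟
  outsideGaps-left {k = k} ℓ D₁ D₂ ρ s x t u sat s<x x≤t =
    to (Sat-⇒ₚ w ρ (s <ₘ x) (outsideGap ℓ D₁ s x t))
       (to (Sat-ifₚ-then w ρ (x ≤ₘ t) left right (from (Sat-≤ₘ w ρ x t) x≤t)) sat) s<x
    where
    left right : Prenex ∃ₕ ℓ k
    left  = s <ₘ x ⇒ₚ outsideGap ℓ D₁ s x t
    right = x ≤ₘ u ⇒ₚ outsideGap ℓ D₂ t x u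

  outsideGaps-right : ∀ ℓ D₁ D₂ (ρ : Assignment m k) s x t u → Sat w ρ ⌞ outsideGaps ℓ D₁ D₂ s x t u ⌟ →
                      pos ρ t < pos ρ x → pos ρ x ≤ pos ρ u → Sat w ρ ⌞ outsideGap ℓ D₂ t x u ⌟
  outsideGaps-right {k = k} ℓ D₁ D₂ ρ s x t u sat t<x x≤u =
    to (Sat-⇒ₚ w ρ (x ≤ₘ u) (outsideGap ℓ D₂ t x u))
       (to (Sat-ifₚ-else w ρ (x ≤ₘ t) left right (<⇒≱ t<x ∘ to (Sat-≤ₘ w ρ x t))) sat) (from (Sat-≤ₘ w ρ x u) x≤u)
    where
    left right : Prenex ∃ₕ ℓ k
    left  = s <ₘ x ⇒ₚ outsideGap ℓ D₁ s x t
    right = x ≤ₘ u ⇒ₚ outsideGap ℓ D₂ t x u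

  mutual
    farOr-sound : ∀ ℓ D₁ D₂ (ρ : Assignment m k) s t u →
                  Sat w ρ ⌞ farOr ℓ D₁ D₂ s t u ⌟ → Far ρ D₁ s t ⊎ Far ρ D₂ t u
    farOr-sound zero D₁ D₂ ρ s t u (inj₁ s≤t) = inj₁ (atLeast-sound D₁ ρ s t s≤t)
    farOr-sound zero D₁ D₂ ρ s t u (inj₂ t≤u) = inj₂ (atLeast-sound D₂ ρ t u t≤u)
    farOr-sound (suc ℓ) D₁ D₂ ρ s t u (a , sat)
      with to (Sat-∨ₚ w (extend a ρ) (wkMatrix (orₘ D₁ D₂ s t u)) (splitAt ℓ D₁ D₂ (wkTerm s) v₀ (wkTerm t) (wkTerm u))) sat
    ... | inj₁ base  = farOr-sound zero D₁ D₂ ρ s t u (strengthen-Sat w a ρ (orₘ D₁ D₂ s t u) base)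
    ... | inj₂ split = ⊎-map (strengthen-Far a ρ D₁ s t) (strengthen-Far a ρ D₂ t u)
                         (splitAt-sound ℓ D₁ D₂ (extend a ρ) _ _ _ _ split)

    splitAt-sound : ∀ ℓ D₁ D₂ (ρ : Assignment m k) s x t u →
                    Sat w ρ ⌞ splitAt ℓ D₁ D₂ s x t u ⌟ → Far ρ D₁ s t ⊎ Far ρ D₂ t u
    splitAt-sound ℓ D₁ D₂ ρ s x t u sat with Sat? w ρ (x ≤ₘ t)
    ... | yes x≤t = inj₁ (halves-join D₁ (proj₁ halves) (proj₂ halves))
      where
      halves : Far ρ ⌈ D₁ /2⌉ s x × Far ρ ⌊ D₁ /2⌋ x t
      halves = farAnd-sound ℓ _ _ ρ s x t
                 (to (Sat-ifₚ-then w ρ (x ≤ₘ t) (farAnd ℓ _ _ s x t) (farAnd ℓ _ _ t x u) x≤t) sat)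
    ... | no  x≰t = inj₂ (halves-join D₂ (proj₁ halves) (proj₂ halves))
      where
      halves : Far ρ ⌈ D₂ /2⌉ t x × Far ρ ⌊ D₂ /2⌋ x u
      halves = farAnd-sound ℓ _ _ ρ t x u
                 (to (Sat-ifₚ-else w ρ (x ≤ₘ t) (farAnd ℓ _ _ s x t) (farAnd ℓ _ _ t x u) x≰t) sat)

    farAnd-sound : ∀ ℓ D₁ D₂ (ρ : Assignment m k) s t u →
                   Sat w ρ ⌞ farAnd ℓ D₁ D₂ s t u ⌟ → Far ρ D₁ s t × Far ρ D₂ t u
    farAnd-sound zero D₁ D₂ ρ s t u (s≤t , t≤u) = atLeast-sound D₁ ρ s t s≤t , atLeast-sound D₂ ρ t u t≤u

    farAnd-sound {k = k} (suc ℓ) D₁ D₂ ρ s t u sat =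
        gap-sound ℓ D₁ ρ s t (atLeast-sound (D₁ ⊓ 1) ρ s t (proj₁ guard))
          (λ a s<a a≤t → outsideGaps-left ℓ D₁ D₂ (extend a ρ) _ _ _ _ (body a)
                           (subst (_< toℕ a) (sym (pos-wkTerm a ρ s)) s<a) (subst (toℕ a ≤_) (sym (pos-wkTerm a ρ t)) a≤t))
      , gap-sound ℓ D₂ ρ t u (atLeast-sound (D₂ ⊓ 1) ρ t u (proj₂ guard))
          (λ a t<a a≤u → outsideGaps-right ℓ D₁ D₂ (extend a ρ) _ _ _ _ (body a)
                           (subst (_< toℕ a) (sym (pos-wkTerm a ρ t)) t<a) (subst (toℕ a ≤_) (sym (pos-wkTerm a ρ u)) a≤u))
      where
      guardₘ : Matrix k
      guardₘ = andₘ (D₁ ⊓ 1) (D₂ ⊓ 1) s t u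
      outside : Prenex ∃ₕ ℓ (suc k)
      outside = outsideGaps ℓ D₁ D₂ (wkTerm s) v₀ (wkTerm t) (wkTerm u)
      guard : Sat w ρ ⌜ guardₘ ⌝
      guard = strengthen-Sat w zero ρ guardₘ (proj₁ (to (Sat-∧ₚ w (extend zero ρ) (wkMatrix guardₘ) outside) (sat zero)))
      body : ∀ a → Sat w (extend a ρ) ⌞ outside ⌟
      body a = proj₂ (to (Sat-∧ₚ w (extend a ρ) (wkMatrix guardₘ) outside) (sat a))

    gap-sound : ∀ ℓ D (ρ : Assignment m k) s t → Far ρ (D ⊓ 1) s t →
                (∀ a → pos ρ s < toℕ a → toℕ a ≤ pos ρ t → Sat w (extend a ρ) ⌞ outsideGap ℓ D (wkTerm s) v₀ (wkTerm t) ⌟) →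
                Far ρ D s t
    gap-sound ℓ D ρ s t guard inside = no-gap D guard λ X s<X X≤t →
      ∀-toℕ (λ Y → pos ρ s < Y → Y ≤ pos ρ t → pos ρ s + ⌈ suc D /2⌉ ≤ Y ⊎ Y + ⌊ suc D /2⌋ ≤ pos ρ t)
            (λ a s<a a≤t → ⊎-map (subst id (Far-to-v₀ a ρ _ s)) (subst id (Far-from-v₀ a ρ _ t))
                              (farOr-sound ℓ _ _ (extend a ρ) _ _ _ (inside a s<a a≤t)))
            X (≤-trans X≤t (pos≤m ρ t)) s<X X≤t

  mutual
    farOr-complete : ∀ ℓ D₁ D₂ → D₁ ≤ reach∃ ℓ → D₂ ≤ reach∃ ℓ → (ρ : Assignment m k) (s t u : Term k) →
                     Far ρ D₁ s t ⊎ Far ρ D₂ t u → Sat w ρ ⌞ farOr ℓ D₁ D₂ s t u ⌟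
    farOr-complete zero D₁ D₂ b₁ b₂ ρ s t u (inj₁ s≤t) = inj₁ (atLeast-complete D₁ b₁ ρ s t s≤t)
    farOr-complete zero D₁ D₂ b₁ b₂ ρ s t u (inj₂ t≤u) = inj₂ (atLeast-complete D₂ b₂ ρ t u t≤u)
    farOr-complete {k = k} (suc ℓ) D₁ D₂ b₁ b₂ ρ s t u far with Sat? w ρ (orₘ D₁ D₂ s t u)
    ... | yes base = zero , from (Sat-∨ₚ w (extend zero ρ) _ split) (inj₁ (weaken-Sat w zero ρ (orₘ D₁ D₂ s t u) base))
      where
      split : Prenex ∀ₕ ℓ (suc k)
      split = splitAt ℓ D₁ D₂ (wkTerm s) v₀ (wkTerm t) (wkTerm u)
    ... | no ¬base with far
    ...   | inj₁ s≤t =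
      a , from (Sat-∨ₚ w (extend a ρ) _ split) (inj₂ (splitAt-left ℓ D₁ D₂ b₁ (extend a ρ) _ v₀ _ _ a≡ s≤t′))
      where
      split : Prenex ∀ₕ ℓ (suc k)
      split = splitAt ℓ D₁ D₂ (wkTerm s) v₀ (wkTerm t) (wkTerm u)
      X≤m : pos ρ s + ⌈ D₁ /2⌉ ≤ m
      X≤m = ≤-trans (≤-trans (+-monoʳ-≤ (pos ρ s) (⌈n/2⌉≤n D₁)) s≤t) (pos≤m ρ t)
      a : Fin (suc m)
      a = fromℕ< (s≤s X≤m)
      a≡ : toℕ a ≡ pos (extend a ρ) (wkTerm s) + ⌈ D₁ /2⌉
      a≡ = trans (toℕ-fromℕ< (s≤s X≤m)) (cong (_+ ⌈ D₁ /2⌉) (sym (pos-wkTerm a ρ s)))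
      s≤t′ : Far (extend a ρ) D₁ (wkTerm s) (wkTerm t)
      s≤t′ = weaken-Far a ρ D₁ s t s≤t
    ...   | inj₂ t≤u =
      a , from (Sat-∨ₚ w (extend a ρ) _ split) (inj₂ (splitAt-right ℓ D₁ D₂ b₂ (extend a ρ) _ v₀ _ _ 0<D₂ a≡ t≤u′))
      where
      split : Prenex ∀ₕ ℓ (suc k)
      split = splitAt ℓ D₁ D₂ (wkTerm s) v₀ (wkTerm t) (wkTerm u)
      X≤m : pos ρ t + ⌈ D₂ /2⌉ ≤ m
      X≤m = ≤-trans (≤-trans (+-monoʳ-≤ (pos ρ t) (⌈n/2⌉≤n D₂)) t≤u) (pos≤m ρ u)
      a : Fin (suc m)
      a = fromℕ< (s≤s X≤m)
      a≡ : toℕ a ≡ pos (extend a ρ) (wkTerm t) + ⌈ D₂ /2⌉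
      a≡ = trans (toℕ-fromℕ< (s≤s X≤m)) (cong (_+ ⌈ D₂ /2⌉) (sym (pos-wkTerm a ρ t)))
      t≤u′ : Far (extend a ρ) D₂ (wkTerm t) (wkTerm u)
      t≤u′ = weaken-Far a ρ D₂ t u t≤u
      0<D₂ : 0 < D₂
      0<D₂ = n≢0⇒n>0 λ D₂≡0 → ¬base (inj₂ (subst (λ D → Sat w ρ ⌜ atLeast D t u ⌝) (sym D₂≡0)
                                               (atLeast-complete 0 z≤n ρ t u (subst (λ D → Far ρ D t u) D₂≡0 t≤u))))

    splitAt-left : ∀ ℓ D₁ D₂ → D₁ ≤ 2 * reach∀ ℓ → (ρ : Assignment m k) (s x t u : Term k) →
                   pos ρ x ≡ pos ρ s + ⌈ D₁ /2⌉ → Far ρ D₁ s t → Sat w ρ ⌞ splitAt ℓ D₁ D₂ s x t u ⌟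
    splitAt-left ℓ D₁ D₂ b₁ ρ s x t u x≡ s≤t =
      from (Sat-ifₚ-then w ρ (x ≤ₘ t) (farAnd ℓ _ _ s x t) (farAnd ℓ _ _ t x u)
              (from (Sat-≤ₘ w ρ x t) (≤-trans (m≤m+n _ _) x+⌊D/2⌋≤t)))
           (farAnd-complete ℓ _ _ (proj₁ (halves-≤ b₁)) (proj₂ (halves-≤ b₁)) ρ s x t (≤-reflexive (sym x≡) , x+⌊D/2⌋≤t))
      where
      x+⌊D/2⌋≤t : pos ρ x + ⌊ D₁ /2⌋ ≤ pos ρ t
      x+⌊D/2⌋≤t = subst (λ y → y + ⌊ D₁ /2⌋ ≤ pos ρ t) (sym x≡) (subst (_≤ pos ρ t) (sym (+-⌈/2⌉+⌊/2⌋ (pos ρ s) D₁)) s≤t)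

    splitAt-right : ∀ ℓ D₁ D₂ → D₂ ≤ 2 * reach∀ ℓ → (ρ : Assignment m k) (s x t u : Term k) → 0 < D₂ →
                    pos ρ x ≡ pos ρ t + ⌈ D₂ /2⌉ → Far ρ D₂ t u → Sat w ρ ⌞ splitAt ℓ D₁ D₂ s x t u ⌟
    splitAt-right ℓ D₁ D₂ b₂ ρ s x t u 0<D₂ x≡ t≤u =
      from (Sat-ifₚ-else w ρ (x ≤ₘ t) (farAnd ℓ _ _ s x t) (farAnd ℓ _ _ t x u) (<⇒≱ t<x ∘ to (Sat-≤ₘ w ρ x t)))
           (farAnd-complete ℓ _ _ (proj₁ (halves-≤ b₂)) (proj₂ (halves-≤ b₂)) ρ t x u (≤-reflexive (sym x≡) , x+⌊D/2⌋≤u))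
      where
      t<x : pos ρ t < pos ρ x
      t<x = subst (pos ρ t <_) (sym x≡)
              (subst (_≤ pos ρ t + ⌈ D₂ /2⌉) (+-comm (pos ρ t) 1) (+-monoʳ-≤ (pos ρ t) (⌈n/2⌉-mono 0<D₂)))
      x+⌊D/2⌋≤u : pos ρ x + ⌊ D₂ /2⌋ ≤ pos ρ u
      x+⌊D/2⌋≤u = subst (λ y → y + ⌊ D₂ /2⌋ ≤ pos ρ u) (sym x≡) (subst (_≤ pos ρ u) (sym (+-⌈/2⌉+⌊/2⌋ (pos ρ t) D₂)) t≤u)

    farAnd-complete : ∀ ℓ D₁ D₂ → D₁ ≤ reach∀ ℓ → D₂ ≤ reach∀ ℓ → (ρ : Assignment m k) (s t u : Term k) →
                      Far ρ D₁ s t × Far ρ D₂ t u → Sat w ρ ⌞ farAnd ℓ D₁ D₂ s t u ⌟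
    farAnd-complete zero D₁ D₂ b₁ b₂ ρ s t u (s≤t , t≤u) = atLeast-complete D₁ b₁ ρ s t s≤t , atLeast-complete D₂ b₂ ρ t u t≤u
    farAnd-complete {k = k} (suc ℓ) D₁ D₂ b₁ b₂ ρ s t u (s≤t , t≤u) a =
      from (Sat-∧ₚ w (extend a ρ) (wkMatrix guardₘ) outside)
           ( weaken-Sat w a ρ guardₘ (guard D₁ ρ s t s≤t , guard D₂ ρ t u t≤u)
           , outsideGaps-complete ℓ D₁ D₂ (<reach∀-suc ℓ b₁) (<reach∀-suc ℓ b₂) (extend a ρ) _ v₀ _ _
               (weaken-Far a ρ D₁ s t s≤t) (weaken-Far a ρ D₂ t u t≤u))
      where
      guardₘ : Matrix k
      guardₘ = andₘ (D₁ ⊓ 1) (D₂ ⊓ 1) s t u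
      outside : Prenex ∃ₕ ℓ (suc k)
      outside = outsideGaps ℓ D₁ D₂ (wkTerm s) v₀ (wkTerm t) (wkTerm u)
      guard : ∀ D ρ s t → Far ρ D s t → Sat w ρ ⌜ atLeast (D ⊓ 1) s t ⌝
      guard D ρ s t s≤t = atLeast-complete (D ⊓ 1) (m⊓n≤n D 1) ρ s t (≤-trans (+-monoʳ-≤ (pos ρ s) (m⊓n≤m D 1)) s≤t)

    outsideGaps-complete : ∀ ℓ D₁ D₂ → suc D₁ ≤ 2 * reach∃ ℓ → suc D₂ ≤ 2 * reach∃ ℓ →
                           (ρ : Assignment m k) (s x t u : Term k) → Far ρ D₁ s t → Far ρ D₂ t u →
                           Sat w ρ ⌞ outsideGaps ℓ D₁ D₂ s x t u ⌟
    outsideGaps-complete {k = k} ℓ D₁ D₂ b₁ b₂ ρ s x t u s≤t t≤u with Sat? w ρ (x ≤ₘ t)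
    ... | yes x≤t = from (Sat-ifₚ-then w ρ (x ≤ₘ t) left right x≤t)
                         (from (Sat-⇒ₚ w ρ (s <ₘ x) (outsideGap ℓ D₁ s x t))
                               (λ _ → farOr-complete ℓ _ _ (proj₁ (halves-≤ b₁)) (proj₂ (halves-≤ b₁)) ρ s x t
                                        (outside-gap D₁ (pos ρ x) s≤t)))
      where
      left right : Prenex ∃ₕ ℓ k
      left  = s <ₘ x ⇒ₚ outsideGap ℓ D₁ s x t
      right = x ≤ₘ u ⇒ₚ outsideGap ℓ D₂ t x u
    ... | no x≰t = from (Sat-ifₚ-else w ρ (x ≤ₘ t) left right x≰t)
                         (from (Sat-⇒ₚ w ρ (x ≤ₘ u) (outsideGap ℓ D₂ t x u))
                               (λ _ → farOr-complete ℓ _ _ (proj₁ (halves-≤ b₂)) (proj₂ (halves-≤ b₂)) ρ t x u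
                                        (outside-gap D₂ (pos ρ x) t≤u)))
      where
      left right : Prenex ∃ₕ ℓ k
      left  = s <ₘ x ⇒ₚ outsideGap ℓ D₁ s x t
      right = x ≤ₘ u ⇒ₚ outsideGap ℓ D₂ t x u

-- The upper bound

pin : ∀ ℓ → Fin (suc m) → Bool → Prenex ∃ₕ (suc ℓ) 0
pin {m} ℓ i b = ∃ₚ (litₘ b v₀ ∧ₚ farAnd ℓ (toℕ i) (m ∸ toℕ i) minT v₀ maxT)

Sat-pin : (w : Vec Bool (suc m)) → ∀ ℓ → m ≤ reach∀ ℓ → (i : Fin (suc m)) (b : Bool) →
          w ⊨ ⌞ pin ℓ i b ⌟ ⇔ lookup w i ≡ b
Sat-pin {m} w ℓ m≤reach i b = mk⇔ to′ from′
  where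
  i≤m : toℕ i ≤ m
  i≤m = toℕ≤pred[n] i
  pinned : Prenex ∀ₕ ℓ 1
  pinned = farAnd ℓ (toℕ i) (m ∸ toℕ i) minT v₀ maxT
  to′ : w ⊨ ⌞ pin ℓ i b ⌟ → lookup w i ≡ b
  to′ (a , sat) with to (Sat-∧ₚ w (extend a noVars) (litₘ b v₀) pinned) sat
  ... | lit , far with farAnd-sound w ℓ _ _ (extend a noVars) minT v₀ maxT far
  ...   | i≤a , a+[m∸i]≤m = subst (λ x → lookup w x ≡ b) a≡i (to (Sat-litₘ w b (extend a noVars) v₀) lit)
    where
    a≤i : toℕ a ≤ toℕ i
    a≤i = subst (toℕ a ≤_) (m∸[m∸n]≡n i≤m)
                (m+n≤o⇒m≤o∸n (toℕ a) (subst (toℕ a + (m ∸ toℕ i) ≤_) (toℕ-fromℕ m) a+[m∸i]≤m))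
    a≡i : a ≡ i
    a≡i = toℕ-injective (≤-antisym a≤i i≤a)
  from′ : lookup w i ≡ b → w ⊨ ⌞ pin ℓ i b ⌟
  from′ wᵢ≡b = i , from (Sat-∧ₚ w (extend i noVars) (litₘ b v₀) pinned)
    ( from (Sat-litₘ w b (extend i noVars) v₀) wᵢ≡b
    , farAnd-complete w ℓ _ _ (≤-trans i≤m m≤reach) (≤-trans (m∸n≤m m (toℕ i)) m≤reach) (extend i noVars) minT v₀ maxT
        (≤-refl , subst (toℕ i + (m ∸ toℕ i) ≤_) (sym (toℕ-fromℕ m)) (≤-reflexive (m+[n∸m]≡n i≤m))))

growth : ∀ j → 2 ^ (j * 2) < 2 * reach∀ (suc (j * 2))
growth zero    = ≤-refl
growth (suc j) =
  *-monoʳ-< 2 (suc[m]≤n⇒m≤pred[n] (subst (_≤ 2 * (2 * reach∀ (suc (j * 2)))) 2*suc≡ (*-monoʳ-≤ 2 (growth j))))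
  where
  2*suc≡ : ∀ {x} → 2 * suc x ≡ suc (suc (2 * x))
  2*suc≡ {x} = cong suc (+-suc x (x + 0))

n<2^suc⌊log₂n⌋ : ∀ n → n < 2 ^ suc ⌊log₂ n ⌋
n<2^suc⌊log₂n⌋ n with n <? 2 ^ suc ⌊log₂ n ⌋
... | yes n<2^ = n<2^
... | no  n≮2^ = ⊥-elim (1+n≰n (subst (_≤ ⌊log₂ n ⌋) (⌊log₂[2^n]⌋≡n _) (⌊log₂⌋-mono-≤ (≮⇒≥ n≮2^))))

even-between : ∀ n → ∃ λ j → n ≤ j * 2 × j * 2 ≤ suc n
even-between zero          = zero , z≤n , z≤n
even-between (suc zero)    = suc zero , s≤s z≤n , ≤-refl
even-between (suc (suc n)) with even-between n
... | j , n≤2j , 2j≤1+n = suc j , s≤s (s≤s n≤2j) , s≤s (s≤s 2j≤1+n)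

differ : ∀ {n} (w w′ : Vec Bool n) → w ≢ w′ → ∃ λ i → lookup w i ≢ lookup w′ i
differ w w′ w≢w′ = ¬∀⟶∃¬ _ _ (λ i → lookup w i Bool.≟ lookup w′ i) (w≢w′ ∘ lookup-ext)
  where
  lookup-ext : (∀ i → lookup w i ≡ lookup w′ i) → w ≡ w′
  lookup-ext eq = trans (sym (tabulate∘lookup w)) (trans (tabulate-cong eq) (tabulate∘lookup w′))

upper-bound : (m : ℕ) (w w′ : Vec Bool (suc m)) → w ≢ w′ →
  Σ Sentence (λ φ → (quantifiers φ ≤ ⌊log₂ (suc m) ⌋ + 6) × AlternatingPrenexEndingForall φ × (w ⊨ φ) × ¬ (w′ ⊨ φ))
upper-bound m w w′ w≢w′ with differ w w′ w≢w′ | even-between (⌊log₂ (suc m) ⌋ + 2)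
... | i , wᵢ≢w′ᵢ | j , L+2≤2j , 2j≤L+3 =
  ⌞ φ ⌟ , bound , inj₂ (∃ₚ-alternates j φ) , from (Sat-pin w depth m≤reach i _) refl ,
  wᵢ≢w′ᵢ ∘ sym ∘ to (Sat-pin w′ depth m≤reach i _)
  where
  L depth : ℕ
  L     = ⌊log₂ (suc m) ⌋
  depth = suc (j * 2)
  φ : Prenex ∃ₕ (suc depth) 0
  φ = pin depth i (lookup w i)
  bound : quantifiers ⌞ φ ⌟ ≤ L + 6
  bound = begin
    quantifiers ⌞ φ ⌟ ≡⟨ quantifiers-⌞⌟ φ ⟩
    2 + j * 2         ≤⟨ +-monoʳ-≤ 2 2j≤L+3 ⟩
    2 + suc (L + 2)   ≡⟨ cong (3 +_) (+-comm L 2) ⟩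
    5 + L             ≤⟨ n≤1+n _ ⟩
    6 + L             ≡⟨ +-comm 6 L ⟩
    L + 6             ∎
    where open ≤-Reasoning
  m≤reach : m ≤ reach∀ depth
  m≤reach = ≤-trans (n≤1+n m) (<⇒≤ (*-cancelˡ-< 2 (suc m) (reach∀ depth) 2[1+m]<2reach))
    where
    open ≤-Reasoning
    2[1+m]<2reach : 2 * suc m < 2 * reach∀ depth
    2[1+m]<2reach = begin-strict
      2 * suc m     <⟨ *-monoʳ-< 2 (n<2^suc⌊log₂n⌋ (suc m)) ⟩
      2 ^ (2 + L)   ≤⟨ ^-monoʳ-≤ 2 (subst (_≤ j * 2) (+-comm L 2) L+2≤2j) ⟩
      2 ^ (j * 2)   <⟨ growth j ⟩
      2 * reach∀ depth  ∎

-- Thresholded distances and similar pairs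

infix 4 _≈⟨_⟩_

_≈⟨_⟩_ : ℕ → ℕ → ℕ → Set
x ≈⟨ T ⟩ y = x ≡ y ⊎ (T ≤ x × T ≤ y)

≈-sym : ∀ {T x y} → x ≈⟨ T ⟩ y → y ≈⟨ T ⟩ x
≈-sym (inj₁ x≡y)        = inj₁ (sym x≡y)
≈-sym (inj₂ (T≤x , T≤y)) = inj₂ (T≤y , T≤x)

≈-weaken : ∀ {T T′ x y} → T′ ≤ T → x ≈⟨ T ⟩ y → x ≈⟨ T′ ⟩ y
≈-weaken T′≤T (inj₁ x≡y)        = inj₁ x≡y
≈-weaken T′≤T (inj₂ (T≤x , T≤y)) = inj₂ (≤-trans T′≤T T≤x , ≤-trans T′≤T T≤y)

≈-≥ : ∀ {T l x y} → x ≈⟨ T ⟩ y → l ≤ x → l ≤ T → l ≤ y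
≈-≥ (inj₁ refl)      l≤x _   = l≤x
≈-≥ (inj₂ (_ , T≤y)) _   l≤T = ≤-trans l≤T T≤y

≈-zero : ∀ {T y} → 1 ≤ T → 0 ≈⟨ T ⟩ y → y ≡ 0
≈-zero 1≤T (inj₁ 0≡y)      = sym 0≡y
≈-zero 1≤T (inj₂ (T≤0 , _)) = ⊥-elim (<⇒≱ 1≤T T≤0)

-- Adding a distance of at least l₂ (resp. l₁) raises the threshold of the other summand by
-- l₂ (resp. l₁).
≈-+ : ∀ {T₁ T₂ T x x′ y y′} l₁ l₂ → x ≈⟨ T₁ ⟩ x′ → y ≈⟨ T₂ ⟩ y′ →
      l₁ ≤ x → l₁ ≤ T₁ → l₂ ≤ y → l₂ ≤ T₂ → T ≤ T₁ + l₂ → T ≤ T₂ + l₁ → x + y ≈⟨ T ⟩ x′ + y′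
≈-+ l₁ l₂ (inj₁ refl) (inj₁ refl) _ _ _ _ _ _ = inj₁ refl
≈-+ l₁ l₂ (inj₂ (T₁≤x , T₁≤x′)) y≈y′ _ _ l₂≤y l₂≤T₂ T≤T₁+l₂ _ =
  inj₂ (≤-trans T≤T₁+l₂ (+-mono-≤ T₁≤x l₂≤y) , ≤-trans T≤T₁+l₂ (+-mono-≤ T₁≤x′ (≈-≥ y≈y′ l₂≤y l₂≤T₂)))
≈-+ {T₂ = T₂} {x = x} {x′} {y} {y′} l₁ l₂ x≈x′@(inj₁ _) (inj₂ (T₂≤y , T₂≤y′)) l₁≤x l₁≤T₁ _ _ _ T≤T₂+l₁ =
  inj₂ (≤-trans T≤T₂+l₁ (subst (_≤ x + y) (+-comm l₁ T₂) (+-mono-≤ l₁≤x T₂≤y)) ,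
        ≤-trans T≤T₂+l₁ (subst (_≤ x′ + y′) (+-comm l₁ T₂) (+-mono-≤ (≈-≥ x≈x′ l₁≤x l₁≤T₁) T₂≤y′)))

record Similar (T p q p′ q′ : ℕ) : Set where
  field
    ≤-forth : p ≤ q → p′ ≤ q′
    ≤-back  : p′ ≤ q′ → p ≤ q
    ≥-forth : q ≤ p → q′ ≤ p′
    ≥-back  : q′ ≤ p′ → q ≤ p
    gap-≤   : p ≤ q → q ∸ p ≈⟨ T ⟩ q′ ∸ p′
    gap-≥   : q ≤ p → p ∸ q ≈⟨ T ⟩ p′ ∸ q′
open Similar public

Similar-flip : ∀ {T p q p′ q′} → Similar T p q p′ q′ → Similar T q p q′ p′
Similar-flip R = record
  { ≤-forth = ≥-forth R ; ≤-back = ≥-back R ; ≥-forth = ≤-forth R ; ≥-back = ≤-back R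
  ; gap-≤ = gap-≥ R ; gap-≥ = gap-≤ R }

Similar-sym : ∀ {T p q p′ q′} → Similar T p q p′ q′ → Similar T p′ q′ p q
Similar-sym R = record
  { ≤-forth = ≤-back R ; ≤-back = ≤-forth R ; ≥-forth = ≥-back R ; ≥-back = ≥-forth R
  ; gap-≤ = ≈-sym ∘ gap-≤ R ∘ ≤-back R ; gap-≥ = ≈-sym ∘ gap-≥ R ∘ ≥-back R }

Similar-weaken : ∀ {T T′ p q p′ q′} → T′ ≤ T → Similar T p q p′ q′ → Similar T′ p q p′ q′
Similar-weaken T′≤T R = record
  { ≤-forth = ≤-forth R ; ≤-back = ≤-back R ; ≥-forth = ≥-forth R ; ≥-back = ≥-back R
  ; gap-≤ = ≈-weaken T′≤T ∘ gap-≤ R ; gap-≥ = ≈-weaken T′≤T ∘ gap-≥ R }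

Similar-refl : ∀ {T p q} → Similar T p q p q
Similar-refl = record
  { ≤-forth = id ; ≤-back = id ; ≥-forth = id ; ≥-back = id
  ; gap-≤ = λ _ → inj₁ refl ; gap-≥ = λ _ → inj₁ refl }

Similar-diag : ∀ {T p p′} → Similar T p p p′ p′
Similar-diag {p = p} {p′} = record
  { ≤-forth = λ _ → ≤-refl ; ≤-back = λ _ → ≤-refl ; ≥-forth = λ _ → ≤-refl ; ≥-back = λ _ → ≤-refl
  ; gap-≤ = λ _ → p∸p≈p′∸p′ ; gap-≥ = λ _ → p∸p≈p′∸p′ }
  where
  p∸p≈p′∸p′ : p ∸ p ≈⟨ _ ⟩ p′ ∸ p′
  p∸p≈p′∸p′ = inj₁ (trans (n∸n≡0 p) (sym (n∸n≡0 p′)))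

Similar-+ : ∀ {T p d p′ d′} → 1 ≤ T → d ≈⟨ T ⟩ d′ → Similar T p (p + d) p′ (p′ + d′)
Similar-+ {T} {p} {d} {p′} {d′} 1≤T d≈d′ = record
  { ≤-forth = λ _ → m≤m+n p′ d′
  ; ≤-back  = λ _ → m≤m+n p d
  ; ≥-forth = λ p+d≤p → ≤-reflexive (back-to-start p′ (≈-zero 1≤T (subst (_≈⟨ T ⟩ d′) (d≡0 p+d≤p) d≈d′)))
  ; ≥-back  = λ p′+d′≤p′ → ≤-reflexive (back-to-start p (≈-zero 1≤T (subst (_≈⟨ T ⟩ d) (d≡0 p′+d′≤p′) (≈-sym d≈d′))))
  ; gap-≤   = λ _ → subst₂ (_≈⟨ T ⟩_) (sym (m+n∸m≡n p d)) (sym (m+n∸m≡n p′ d′)) d≈d′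
  ; gap-≥   = λ p+d≤p → inj₁ (trans (m≤n⇒m∸n≡0 (m≤m+n p d)) (sym (m≤n⇒m∸n≡0 (m≤m+n p′ d′)))) }
  where
  d≡0 : ∀ {q e} → q + e ≤ q → e ≡ 0
  d≡0 {q} {e} q+e≤q = n≤0⇒n≡0 (+-cancelˡ-≤ q e 0 (subst (q + e ≤_) (sym (+-identityʳ q)) q+e≤q))
  back-to-start : ∀ q {e} → e ≡ 0 → q + e ≡ q
  back-to-start q refl = +-identityʳ q

Similar-+′ : ∀ {T p q p′ q′} d d′ → 1 ≤ T → q ≡ p + d → q′ ≡ p′ + d′ → d ≈⟨ T ⟩ d′ → Similar T p q p′ q′
Similar-+′ d d′ 1≤T refl refl = Similar-+ 1≤T

Similar-gap : ∀ {T p q p′ q′} → Similar T p q p′ q′ → p ≤ q →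
              ∃₂ λ d d′ → q ≡ p + d × q′ ≡ p′ + d′ × d ≈⟨ T ⟩ d′
Similar-gap R p≤q = _ , _ , sym (m+[n∸m]≡n p≤q) , sym (m+[n∸m]≡n (≤-forth R p≤q)) , gap-≤ R p≤q

Similar-trans : ∀ {T₁ T₂ T p q z p′ q′ z′} l₁ l₂ → Similar T₁ p q p′ q′ → Similar T₂ q z q′ z′ → p ≤ q → q ≤ z →
                l₁ ≤ q ∸ p → l₁ ≤ T₁ → l₂ ≤ z ∸ q → l₂ ≤ T₂ → T ≤ T₁ + l₂ → T ≤ T₂ + l₁ → 1 ≤ T →
                Similar T p z p′ z′
Similar-trans {p = p} {p′ = p′} l₁ l₂ R₁ R₂ p≤q q≤z l₁≤ l₁≤T₁ l₂≤ l₂≤T₂ T≤₁ T≤₂ 1≤T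
  with Similar-gap R₁ p≤q | Similar-gap R₂ q≤z
... | d₁ , d₁′ , refl , refl , d₁≈ | d₂ , d₂′ , refl , refl , d₂≈ =
  Similar-+′ (d₁ + d₂) (d₁′ + d₂′) 1≤T (+-assoc p d₁ d₂) (+-assoc p′ d₁′ d₂′)
    (≈-+ l₁ l₂ d₁≈ d₂≈ (subst (l₁ ≤_) (m+n∸m≡n p d₁) l₁≤) l₁≤T₁ (subst (l₂ ≤_) (m+n∸m≡n (p + d₁) d₂) l₂≤) l₂≤T₂ T≤₁ T≤₂)

Similar-trans₀ : ∀ {T₁ T₂ T p q z p′ q′ z′} → Similar T₁ p q p′ q′ → Similar T₂ q z q′ z′ → p ≤ q → q ≤ z →
                 T ≤ T₁ → T ≤ T₂ → 1 ≤ T → Similar T p z p′ z′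
Similar-trans₀ {T₁} {T₂} {T} S₁ S₂ p≤q q≤z T≤T₁ T≤T₂ =
  Similar-trans 0 0 S₁ S₂ p≤q q≤z z≤n z≤n z≤n z≤n
    (subst (T ≤_) (sym (+-identityʳ T₁)) T≤T₁) (subst (T ≤_) (sym (+-identityʳ T₂)) T≤T₂)

Similar-≡ : ∀ {T p q p′ q′} → Similar T p q p′ q′ → p ≡ q → p′ ≡ q′
Similar-≡ R refl = ≤-antisym (≤-forth R ≤-refl) (≥-forth R ≤-refl)

Similar-< : ∀ {T p q p′ q′} → Similar T p q p′ q′ → p < q → p′ < q′
Similar-< R p<q = ≤∧≢⇒< (≤-forth R (<⇒≤ p<q)) (<⇒≢ p<q ∘ Similar-≡ (Similar-sym R))

≤-remainder : ∀ A B x y → A + B ≤ x + y → x ≤ A → B ≤ y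
≤-remainder A B x y A+B≤x+y x≤A = +-cancelˡ-≤ A B y (≤-trans A+B≤x+y (+-monoˡ-≤ y x≤A))

∸-split : ∀ {L a U G} → L ≤ a → a ≤ U → U ≡ L + G → (a ∸ L) + (U ∸ a) ≡ G
∸-split {L} {a} {U} L≤a a≤U U≡L+G = +-cancelˡ-≡ L _ _ (begin
  L + ((a ∸ L) + (U ∸ a)) ≡⟨ +-assoc L (a ∸ L) (U ∸ a) ⟨
  L + (a ∸ L) + (U ∸ a)   ≡⟨ cong (_+ (U ∸ a)) (m+[n∸m]≡n L≤a) ⟩
  a + (U ∸ a)             ≡⟨ m+[n∸m]≡n a≤U ⟩
  U                       ≡⟨ U≡L+G ⟩
  L + _                   ∎)
  where open ≡-Reasoning

gap-positive : ∀ {p q d} → p < q → q ≡ p + d → 1 ≤ d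
gap-positive {p} {d = zero}  p<q q≡p+0 = ⊥-elim (<⇒≱ p<q (≤-reflexive (trans q≡p+0 (+-identityʳ p))))
gap-positive     {d = suc d} p<q q≡p+d = s≤s z≤n

≈-+ˡ : ∀ {T T′ Y Y′} e → T′ ≤ e + T → Y ≈⟨ T ⟩ Y′ → e + Y ≈⟨ T′ ⟩ e + Y′
≈-+ˡ e T′≤e+T (inj₁ refl)        = inj₁ refl
≈-+ˡ e T′≤e+T (inj₂ (T≤Y , T≤Y′)) = inj₂ (≤-trans T′≤e+T (+-monoʳ-≤ e T≤Y) , ≤-trans T′≤e+T (+-monoʳ-≤ e T≤Y′))

≈-cancelˡ : ∀ {T T′ A B} x → x + T′ ≤ T → x + A ≈⟨ T ⟩ x + B → A ≈⟨ T′ ⟩ B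
≈-cancelˡ x x+T′≤T (inj₁ x+A≡x+B)      = inj₁ (+-cancelˡ-≡ x _ _ x+A≡x+B)
≈-cancelˡ x x+T′≤T (inj₂ (T≤x+A , T≤x+B)) =
  inj₂ (+-cancelˡ-≤ x _ _ (≤-trans x+T′≤T T≤x+A) , +-cancelˡ-≤ x _ _ (≤-trans x+T′≤T T≤x+B))

split-gap : ∀ H {G G′} x g → G ≈⟨ H + H ⟩ G′ → x + g ≡ G →
            ∃₂ λ x′ g′ → x′ + g′ ≡ G′ × x ≈⟨ H ⟩ x′ × g ≈⟨ H ⟩ g′
split-gap H x g (inj₁ refl) x+g≡G = x , g , x+g≡G , inj₁ refl , inj₁ refl
split-gap H {G′ = G′} x g (inj₂ (2H≤G , 2H≤G′)) refl with x <? H | g <? H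
... | yes x<H | _ =
  x , G′ ∸ x , m+[n∸m]≡n x≤G′ , inj₁ refl , inj₂ (H≤g , m+n≤o⇒m≤o∸n H (≤-trans (+-monoʳ-≤ H (<⇒≤ x<H)) 2H≤G′))
  where
  x≤G′ : x ≤ G′
  x≤G′ = ≤-trans (<⇒≤ x<H) (≤-trans (m≤m+n H H) 2H≤G′)
  H≤g : H ≤ g
  H≤g = ≤-remainder H H x g 2H≤G (<⇒≤ x<H)
... | no x≮H | yes g<H =
  G′ ∸ g , g , m∸n+n≡m g≤G′ , inj₂ (≮⇒≥ x≮H , m+n≤o⇒m≤o∸n H (≤-trans (+-monoʳ-≤ H (<⇒≤ g<H)) 2H≤G′)) , inj₁ refl
  where
  g≤G′ : g ≤ G′
  g≤G′ = ≤-trans (<⇒≤ g<H) (≤-trans (m≤m+n H H) 2H≤G′)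
... | no x≮H | no g≮H = H , G′ ∸ H , m+[n∸m]≡n (≤-trans (m≤m+n H H) 2H≤G′) , inj₂ (≮⇒≥ x≮H , ≤-refl) ,
                        inj₂ (≮⇒≥ g≮H , m+n≤o⇒m≤o∸n H 2H≤G′)

-- The gap from a pebble L to the marked position c (length X) and on to the next pebble U
-- (length Y) is cut by a new point a < c, with x = a − L and e = c − a.  The new distance e
-- to the mark only needs threshold Hm, but e + Y, which straddles the mark, needs suc (suc Hm).
split-marked-gap : ∀ Hm {X X′ Y Y′} x e → 1 ≤ Hm → 1 ≤ Y → 1 ≤ e → x + e ≡ X →
  X ≈⟨ suc Hm + Hm ⟩ X′ → Y ≈⟨ suc Hm + Hm ⟩ Y′ → X + Y ≈⟨ suc (suc Hm + suc Hm) ⟩ X′ + Y′ →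
  ∃₂ λ x′ e′ → x′ + e′ ≡ X′ × 1 ≤ e′ × x ≈⟨ suc Hm ⟩ x′ × e ≈⟨ Hm ⟩ e′ × e + Y ≈⟨ suc (suc Hm) ⟩ e′ + Y′
split-marked-gap Hm x e 1≤Hm 1≤Y 1≤e refl (inj₁ refl) Y≈Y′ _ =
  x , e , refl , 1≤e , inj₁ refl , inj₁ refl , ≈-+ˡ e (+-mono-≤ 1≤e (m≤m+n (suc Hm) Hm)) Y≈Y′
split-marked-gap Hm {X′ = X′} {Y} {Y′} x e 1≤Hm 1≤Y 1≤e refl (inj₂ (T≤X , T≤X′)) Y≈Y′ X+Y≈X′+Y′
  with x <? suc Hm | e <? Hm | suc Hm + e ≤? X′
... | yes x<H | _ | _ =
  x , X′ ∸ x , m+[n∸m]≡n x≤X′ , ≤-trans 1≤Hm Hm≤X′∸x , inj₁ refl ,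
  inj₂ (≤-remainder (suc Hm) Hm x e T≤X x≤H , Hm≤X′∸x) ,
  ≈-cancelˡ x x≤H′
    (subst₂ (_≈⟨ suc (suc Hm + suc Hm) ⟩_) (+-assoc x e Y)
            (trans (cong (_+ Y′) (sym (m+[n∸m]≡n x≤X′))) (+-assoc x _ Y′)) X+Y≈X′+Y′)
  where
  x≤H : x ≤ suc Hm
  x≤H = <⇒≤ x<H
  x≤H′ : x + suc (suc Hm) ≤ suc (suc Hm + suc Hm)
  x≤H′ = ≤-trans (+-monoˡ-≤ (suc (suc Hm)) x≤H) (≤-reflexive (cong suc (+-suc Hm (suc Hm))))
  x≤X′ : x ≤ X′
  x≤X′ = ≤-trans x≤H (≤-trans (m≤m+n (suc Hm) Hm) T≤X′)
  Hm≤X′∸x : Hm ≤ X′ ∸ x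
  Hm≤X′∸x = m+n≤o⇒m≤o∸n Hm (≤-trans (subst (_≤ suc Hm + Hm) (+-comm x Hm) (+-monoˡ-≤ Hm x≤H)) T≤X′)
... | no x≮H | yes e<Hm | _ =
  X′ ∸ e , e , m∸n+n≡m e≤X′ , 1≤e , inj₂ (≮⇒≥ x≮H , m+n≤o⇒m≤o∸n (suc Hm) (≤-trans (+-monoʳ-≤ (suc Hm) (<⇒≤ e<Hm)) T≤X′)) ,
  inj₁ refl , ≈-+ˡ e (+-mono-≤ 1≤e (m≤m+n (suc Hm) Hm)) Y≈Y′
  where
  e≤X′ : e ≤ X′
  e≤X′ = ≤-trans (<⇒≤ e<Hm) (≤-trans (m≤n+m Hm (suc Hm)) T≤X′)
... | no x≮H | no e≮Hm | yes H+e≤X′ =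
  X′ ∸ e , e , m∸n+n≡m (≤-trans (m≤n+m e (suc Hm)) H+e≤X′) , 1≤e , inj₂ (≮⇒≥ x≮H , m+n≤o⇒m≤o∸n (suc Hm) H+e≤X′) ,
  inj₁ refl , ≈-+ˡ e (+-mono-≤ 1≤e (m≤m+n (suc Hm) Hm)) Y≈Y′
... | no x≮H | no e≮Hm | no H+e≰X′ =
  suc Hm , X′ ∸ suc Hm , m+[n∸m]≡n H≤X′ , ≤-trans 1≤Hm Hm≤e′ , inj₂ (≮⇒≥ x≮H , ≤-refl) , inj₂ (≮⇒≥ e≮Hm , Hm≤e′) ,
  inj₂ (subst (_≤ e + Y) (+-comm (suc Hm) 1) (+-mono-≤ H≤e 1≤Y) , H<e′+Y′)
  where
  H≤X′ : suc Hm ≤ X′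
  H≤X′ = ≤-trans (m≤m+n (suc Hm) Hm) T≤X′
  Hm≤e′ : Hm ≤ X′ ∸ suc Hm
  Hm≤e′ = m+n≤o⇒m≤o∸n Hm (subst (_≤ X′) (+-comm (suc Hm) Hm) T≤X′)
  X′<H+e : X′ < suc Hm + e
  X′<H+e = ≰⇒> H+e≰X′
  H≤e : suc Hm ≤ e
  H≤e = +-cancelˡ-≤ (suc Hm) (suc Hm) e (≤-trans (≤-reflexive (cong suc (+-suc Hm Hm))) (≤-trans (s≤s T≤X′) X′<H+e))
  1≤Y′ : 1 ≤ Y′
  1≤Y′ = ≈-≥ Y≈Y′ 1≤Y (s≤s z≤n)
  H<e′+Y′ : suc (suc Hm) ≤ X′ ∸ suc Hm + Y′
  H<e′+Y′ with 2 ≤? Y′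
  ... | yes 2≤Y′ = subst (_≤ X′ ∸ suc Hm + Y′) (+-comm Hm 2) (+-mono-≤ Hm≤e′ 2≤Y′)
  ... | no  2≰Y′ = subst (λ y → suc (suc Hm) ≤ X′ ∸ suc Hm + y) (sym Y′≡1)
                     (subst (_≤ X′ ∸ suc Hm + 1) (+-comm (suc Hm) 1) (+-monoˡ-≤ 1 (m+n≤o⇒m≤o∸n (suc Hm) 2H≤X′)))
    where
    Y′≡1 : Y′ ≡ 1
    Y′≡1 = ≤-antisym (≤-pred (≰⇒> 2≰Y′)) 1≤Y′
    Y≡1 : Y ≡ 1
    Y≡1 = [ (λ Y≡Y′ → trans Y≡Y′ Y′≡1)
          , (λ (_ , T≤Y′) → ⊥-elim (<⇒≱ (s≤s (≤-trans 1≤Hm (m≤n+m Hm Hm))) (subst (suc Hm + Hm ≤_) Y′≡1 T≤Y′)))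
          ]′ Y≈Y′
    2H≤X′ : suc Hm + suc Hm ≤ X′
    2H≤X′ = [ (λ X+Y≡X′+Y′ → ⊥-elim (<⇒≱ X′<H+e (≤-trans (+-monoˡ-≤ e (≮⇒≥ x≮H))
                (≤-reflexive (+-cancelʳ-≡ 1 _ _ (subst₂ (λ y y′ → x + e + y ≡ X′ + y′) Y≡1 Y′≡1 X+Y≡X′+Y′))))))
            , (λ (_ , 2H+1≤X′+Y′) →
                 ≤-pred (subst (suc (suc Hm + suc Hm) ≤_) (trans (cong (X′ +_) Y′≡1) (+-comm X′ 1)) 2H+1≤X′+Y′))
            ]′ X+Y≈X′+Y′

-- Game positions

nearest-below : ∀ {N} (f : Fin N → ℕ) a →
  (∃ λ l → f l ≤ a × (∀ j → f j ≤ a → f j ≤ f l)) ⊎ (∀ j → a < f j)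
nearest-below {zero}  f a = inj₂ (λ ())
nearest-below {suc N} f a with nearest-below (f ∘ suc) a | f zero ≤? a
... | inj₂ above | yes f₀≤a = inj₁ (zero , f₀≤a , λ { zero _ → ≤-refl ; (suc j) fj≤a → ⊥-elim (<⇒≱ (above j) fj≤a) })
... | inj₂ above | no  f₀≰a = inj₂ λ { zero → ≰⇒> f₀≰a ; (suc j) → above j }
... | inj₁ (l , fl≤a , max) | no f₀≰a = inj₁ (suc l , fl≤a , λ { zero f₀≤a → ⊥-elim (f₀≰a f₀≤a) ; (suc j) → max j })
... | inj₁ (l , fl≤a , max) | yes f₀≤a with f zero ≤? f (suc l)
...   | yes f₀≤fl = inj₁ (suc l , fl≤a , λ { zero _ → f₀≤fl ; (suc j) → max j })
...   | no  f₀≰fl = inj₁ (zero , f₀≤a , λ { zero _ → ≤-refl ; (suc j) fj≤a → ≤-trans (max j fj≤a) (<⇒≤ (≰⇒> f₀≰fl)) })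

nearest-above : ∀ {N} (f : Fin N → ℕ) a →
  (∃ λ u → a ≤ f u × (∀ j → a ≤ f j → f u ≤ f j)) ⊎ (∀ j → f j < a)
nearest-above {zero}  f a = inj₂ (λ ())
nearest-above {suc N} f a with nearest-above (f ∘ suc) a | a ≤? f zero
... | inj₂ below | yes a≤f₀ = inj₁ (zero , a≤f₀ , λ { zero _ → ≤-refl ; (suc j) a≤fj → ⊥-elim (<⇒≱ (below j) a≤fj) })
... | inj₂ below | no  a≰f₀ = inj₂ λ { zero → ≰⇒> a≰f₀ ; (suc j) → below j }
... | inj₁ (u , a≤fu , min) | no a≰f₀ = inj₁ (suc u , a≤fu , λ { zero a≤f₀ → ⊥-elim (a≰f₀ a≤f₀) ; (suc j) → min j })
... | inj₁ (u , a≤fu , min) | yes a≤f₀ with f (suc u) ≤? f zero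
...   | yes fu≤f₀ = inj₁ (suc u , a≤fu , λ { zero _ → fu≤f₀ ; (suc j) → min j })
...   | no  fu≰f₀ = inj₁ (zero , a≤f₀ , λ { zero _ → ≤-refl ; (suc j) a≤fj → ≤-trans (<⇒≤ (≰⇒> fu≰f₀)) (min j a≤fj) })

-- Pebbles at positions f and f′ of two strings whose only 1s are at c and c′.  Pairs of pebbles
-- on opposite sides of the mark must agree up to one more than T, distances to the mark only
-- up to T ∸ 1; this asymmetry is what lets the marks 2 ^ r ∸ 1 and 2 ^ r start out matched.
record Matching (T : ℕ) {N : ℕ} (f f′ : Fin N → ℕ) (c c′ : ℕ) : Set where
  field
    pairs  : ∀ i j → Similar T (f i) (f j) (f′ i) (f′ j)
    across : ∀ i j → f i < c → c < f j → Similar (suc T) (f i) (f j) (f′ i) (f′ j)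
    toMark : ∀ i → Similar (T ∸ 1) (f i) c (f′ i) c′
open Matching public

record PartialIso {N : ℕ} (f f′ : Fin N → ℕ) (c c′ : ℕ) : Set where
  field
    order-forth : ∀ i j → f i ≤ f j → f′ i ≤ f′ j
    order-back  : ∀ i j → f′ i ≤ f′ j → f i ≤ f j
    mark-forth  : ∀ i → f i ≡ c → f′ i ≡ c′
    mark-back   : ∀ i → f′ i ≡ c′ → f i ≡ c
open PartialIso public

Matching-sym : ∀ {T N} {f f′ : Fin N → ℕ} {c c′} → Matching T f f′ c c′ → Matching T f′ f c′ c
Matching-sym M = record
  { pairs  = λ i j → Similar-sym (pairs M i j)
  ; across = λ i j fi<c fj>c → Similar-sym (across M i j (Similar-< (Similar-sym (toMark M i)) fi<c)
                                                       (Similar-< (Similar-sym (Similar-flip (toMark M j))) fj>c))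
  ; toMark = λ i → Similar-sym (toMark M i) }

PartialIso-sym : ∀ {N} {f f′ : Fin N → ℕ} {c c′} → PartialIso f f′ c c′ → PartialIso f′ f c′ c
PartialIso-sym P = record
  { order-forth = order-back P ; order-back = order-forth P ; mark-forth = mark-back P ; mark-back = mark-forth P }

Matching⇒PartialIso : ∀ {T N} {f f′ : Fin N → ℕ} {c c′} → Matching T f f′ c c′ → PartialIso f f′ c c′
Matching⇒PartialIso M = record
  { order-forth = λ i j → ≤-forth (pairs M i j) ; order-back = λ i j → ≤-back (pairs M i j)
  ; mark-forth = λ i → Similar-≡ (toMark M i) ; mark-back = λ i → Similar-≡ (Similar-sym (toMark M i)) }

-- Spoiler places a new pebble at a ≤ m in the first string; L ≤ a ≤ U are the nearest old pebbles.
module Respond (H : ℕ) (1≤H : 1 ≤ H) {N : ℕ} {f f′ : Fin N → ℕ} {c c′ m : ℕ}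
               (M : Matching (H + H) f f′ c c′)
               (i₀ i₁ : Fin N) (fi₀≡0 : f i₀ ≡ 0) (fi₁≡m : f i₁ ≡ m) (f′≤m : ∀ i → f′ i ≤ m)
               (a : ℕ) (a≤m : a ≤ m) where

  below : ∃ λ l → f l ≤ a × (∀ j → f j ≤ a → f j ≤ f l)
  below with nearest-below f a
  ... | inj₁ found = found
  ... | inj₂ above = ⊥-elim (<⇒≱ (above i₀) (subst (_≤ a) (sym fi₀≡0) z≤n))

  above : ∃ λ u → a ≤ f u × (∀ j → a ≤ f j → f u ≤ f j)
  above with nearest-above f a
  ... | inj₁ found = found
  ... | inj₂ below = ⊥-elim (<⇒≱ (below i₁) (subst (a ≤_) (sym fi₁≡m) a≤m))

  l u : Fin N
  l = proj₁ below
  u = proj₁ above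

  L U L′ U′ : ℕ
  L  = f l
  U  = f u
  L′ = f′ l
  U′ = f′ u

  L≤a : L ≤ a
  L≤a = proj₁ (proj₂ below)

  a≤U : a ≤ U
  a≤U = proj₁ (proj₂ above)

  L≤U : L ≤ U
  L≤U = ≤-trans L≤a a≤U

  new-pairs : ∀ a′ → Similar H L a L′ a′ → Similar H a U a′ U′ → ∀ j → Similar H a (f j) a′ (f′ j)
  new-pairs a′ SL SU j with f j ≤? a
  ... | yes fj≤a = Similar-flip (Similar-trans₀ (pairs M j l) SL (proj₂ (proj₂ below) j fj≤a) L≤a (m≤m+n H H) ≤-refl 1≤H)
  ... | no  fj≰a = Similar-trans₀ SU (pairs M u j) a≤U (proj₂ (proj₂ above) j (<⇒≤ (≰⇒> fj≰a))) ≤-refl (m≤m+n H H) 1≤H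

  1+H≤2H : suc H ≤ H + H
  1+H≤2H = subst (_≤ H + H) (+-comm H 1) (+-monoʳ-≤ H 1≤H)

  new-across-left : ∀ a′ → Similar H L a L′ a′ → (L < c → c < a → Similar (suc H) L a L′ a′) →
                    ∀ j → f j < c → c < a → Similar (suc H) (f j) a (f′ j) a′
  new-across-left a′ SL SL⁺ j fj<c c<a with L <? c
  ... | yes L<c = Similar-trans₀ (pairs M j l) (SL⁺ L<c c<a) fj≤L L≤a 1+H≤2H ≤-refl (s≤s z≤n)
    where
    fj≤L : f j ≤ L
    fj≤L = proj₂ (proj₂ below) j (<⇒≤ (<-trans fj<c c<a))
  ... | no  L≮c = Similar-trans 1 0 (pairs M j l) SL fj≤L L≤a (m<n⇒0<n∸m (<-≤-trans fj<c (≮⇒≥ L≮c)))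
                    (≤-trans 1≤H (m≤m+n H H)) z≤n z≤n (subst (suc H ≤_) (sym (+-identityʳ _)) 1+H≤2H)
                    (≤-reflexive (+-comm 1 H)) (s≤s z≤n)
    where
    fj≤L : f j ≤ L
    fj≤L = proj₂ (proj₂ below) j (<⇒≤ (<-trans fj<c c<a))

  new-across-right : ∀ a′ → Similar H a U a′ U′ → (a < c → c < U → Similar (suc H) a U a′ U′) →
                     ∀ j → a < c → c < f j → Similar (suc H) a (f j) a′ (f′ j)
  new-across-right a′ SU SU⁺ j a<c c<fj with c <? U
  ... | yes c<U = Similar-trans₀ (SU⁺ a<c c<U) (pairs M u j) a≤U U≤fj ≤-refl 1+H≤2H (s≤s z≤n)
    where
    U≤fj : U ≤ f j
    U≤fj = proj₂ (proj₂ above) j (<⇒≤ (<-trans a<c c<fj))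
  ... | no  c≮U = Similar-trans 0 1 SU (pairs M u j) a≤U U≤fj z≤n z≤n (m<n⇒0<n∸m (≤-<-trans (≮⇒≥ c≮U) c<fj))
                    (≤-trans 1≤H (m≤m+n H H)) (≤-reflexive (+-comm 1 H)) (subst (suc H ≤_) (sym (+-identityʳ _)) 1+H≤2H)
                    (s≤s z≤n)
    where
    U≤fj : U ≤ f j
    U≤fj = proj₂ (proj₂ above) j (<⇒≤ (<-trans a<c c<fj))

  respond-in-gap : ∃ λ a′ → a′ ≤ U′ × Similar H L a L′ a′ × Similar H a U a′ U′
  respond-in-gap with Similar-gap (pairs M l u) L≤U
  ... | G , G′ , U≡L+G , U′≡L′+G′ , G≈G′ with split-gap H (a ∸ L) (U ∸ a) G≈G′ (∸-split L≤a a≤U U≡L+G)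
  ...   | x′ , g′ , x′+g′≡G′ , x≈x′ , g≈g′ =
    L′ + x′ , ≤-trans (m≤m+n (L′ + x′) g′) (≤-reflexive (sym U′≡L′+x′+g′)) ,
    Similar-+′ (a ∸ L) x′ 1≤H (sym (m+[n∸m]≡n L≤a)) refl x≈x′ ,
    Similar-+′ (U ∸ a) g′ 1≤H (sym (m+[n∸m]≡n a≤U)) U′≡L′+x′+g′ g≈g′
    where
    U′≡L′+x′+g′ : U′ ≡ (L′ + x′) + g′
    U′≡L′+x′+g′ = trans U′≡L′+G′ (trans (cong (L′ +_) (sym x′+g′≡G′)) (sym (+-assoc L′ x′ g′)))

  extend-Matching : ∀ a′ → (∀ j → Similar H a (f j) a′ (f′ j)) →
    (∀ j → f j < c → c < a → Similar (suc H) (f j) a (f′ j) a′) →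
    (∀ j → a < c → c < f j → Similar (suc H) a (f j) a′ (f′ j)) →
    Similar (H ∸ 1) a c a′ c′ → Matching H (a ∷ f) (a′ ∷ f′) c c′
  extend-Matching a′ new new-left new-right new-mark = record { pairs = pairs′ ; across = across′ ; toMark = toMark′ }
    where
    pairs′ : ∀ i j → Similar H ((a ∷ f) i) ((a ∷ f) j) ((a′ ∷ f′) i) ((a′ ∷ f′) j)
    pairs′ zero    zero    = Similar-diag
    pairs′ zero    (suc j) = new j
    pairs′ (suc i) zero    = Similar-flip (new i)
    pairs′ (suc i) (suc j) = Similar-weaken (m≤m+n H H) (pairs M i j)
    across′ : ∀ i j → (a ∷ f) i < c → c < (a ∷ f) j →
              Similar (suc H) ((a ∷ f) i) ((a ∷ f) j) ((a′ ∷ f′) i) ((a′ ∷ f′) j)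
    across′ zero    zero    a<c c<a = ⊥-elim (<-asym a<c c<a)
    across′ zero    (suc j) a<c c<fj = new-right j a<c c<fj
    across′ (suc i) zero    fi<c c<a = new-left i fi<c c<a
    across′ (suc i) (suc j) fi<c c<fj = Similar-weaken (s≤s (m≤m+n H H)) (across M i j fi<c c<fj)
    toMark′ : ∀ i → Similar (H ∸ 1) ((a ∷ f) i) c ((a′ ∷ f′) i) c′
    toMark′ zero    = new-mark
    toMark′ (suc i) = Similar-weaken (∸-monoˡ-≤ 1 (m≤m+n H H)) (toMark M i)

module RespondMatching (Hm : ℕ) (1≤Hm : 1 ≤ Hm) {N : ℕ} {f f′ : Fin N → ℕ} {c c′ m : ℕ}
                       (M : Matching (suc Hm + suc Hm) f f′ c c′)
                       (i₀ i₁ : Fin N) (fi₀≡0 : f i₀ ≡ 0) (fi₁≡m : f i₁ ≡ m) (f′≤m : ∀ i → f′ i ≤ m)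
                       (a : ℕ) (a≤m : a ≤ m) where

  open Respond (suc Hm) (s≤s z≤n) M i₀ i₁ fi₀≡0 fi₁≡m f′≤m a a≤m

  H : ℕ
  H = suc Hm

  Response : Set
  Response = ∃ λ a′ → a′ ≤ m × Matching H (a ∷ f) (a′ ∷ f′) c c′

  respond-with : ∀ a′ → a′ ≤ U′ → Similar H L a L′ a′ → Similar H a U a′ U′ →
                 (L < c → c < a → Similar (suc H) L a L′ a′) → (a < c → c < U → Similar (suc H) a U a′ U′) →
                 Similar Hm a c a′ c′ → Response
  respond-with a′ a′≤U′ SL SU SL⁺ SU⁺ S-mark = a′ , ≤-trans a′≤U′ (f′≤m u) ,
    extend-Matching a′ (new-pairs a′ SL SU) (new-across-left a′ SL SL⁺) (new-across-right a′ SU SU⁺) S-mark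

  mark-before-gap : c ≤ L → Response
  mark-before-gap c≤L with respond-in-gap
  ... | a′ , a′≤U′ , SL , SU =
    respond-with a′ a′≤U′ SL SU (λ L<c _ → ⊥-elim (<⇒≱ L<c c≤L)) (λ a<c _ → ⊥-elim (<⇒≱ a<c (≤-trans c≤L L≤a)))
      (Similar-flip (Similar-trans₀ (Similar-flip (toMark M l)) SL c≤L L≤a (m≤m+n Hm (suc Hm)) (n≤1+n Hm) 1≤Hm))

  mark-after-gap : U ≤ c → Response
  mark-after-gap U≤c with respond-in-gap
  ... | a′ , a′≤U′ , SL , SU =
    respond-with a′ a′≤U′ SL SU (λ _ c<a → ⊥-elim (<⇒≱ c<a (≤-trans a≤U U≤c))) (λ _ c<U → ⊥-elim (<⇒≱ c<U U≤c))
      (Similar-trans₀ SU (toMark M u) a≤U U≤c (n≤1+n Hm) (m≤m+n Hm (suc Hm)) 1≤Hm)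

  mark-in-gap : L < c → c < U → Response
  mark-in-gap L<c c<U
    with Similar-gap (toMark M l) (<⇒≤ L<c) | Similar-gap (Similar-flip (toMark M u)) (<⇒≤ c<U)
       | Similar-gap (across M l u L<c c<U) L≤U
  ... | X , X′ , c≡L+X , c′≡L′+X′ , X≈X′ | Y , Y′ , U≡c+Y , U′≡c′+Y′ , Y≈Y′ | D , D′ , U≡L+D , U′≡L′+D′ , D≈D′ =
    by-position (<-cmp a c)
    where
    X≈X′ᵀ : X ≈⟨ suc Hm + Hm ⟩ X′
    X≈X′ᵀ = subst (λ T → X ≈⟨ T ⟩ X′) (+-comm Hm (suc Hm)) X≈X′
    Y≈Y′ᵀ : Y ≈⟨ suc Hm + Hm ⟩ Y′
    Y≈Y′ᵀ = subst (λ T → Y ≈⟨ T ⟩ Y′) (+-comm Hm (suc Hm)) Y≈Y′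
    D≡X+Y : D ≡ X + Y
    D≡X+Y = +-cancelˡ-≡ L D (X + Y) (trans (sym U≡L+D) (trans U≡c+Y (trans (cong (_+ Y) c≡L+X) (+-assoc L X Y))))
    D′≡X′+Y′ : D′ ≡ X′ + Y′
    D′≡X′+Y′ = +-cancelˡ-≡ L′ D′ (X′ + Y′)
                 (trans (sym U′≡L′+D′) (trans U′≡c′+Y′ (trans (cong (_+ Y′) c′≡L′+X′) (+-assoc L′ X′ Y′))))
    X+Y≈X′+Y′ : X + Y ≈⟨ suc (H + H) ⟩ X′ + Y′
    X+Y≈X′+Y′ = subst₂ (_≈⟨ suc (H + H) ⟩_) D≡X+Y D′≡X′+Y′ D≈D′
    H≤2H-1 : H ≤ Hm + suc Hm
    H≤2H-1 = m≤n+m (suc Hm) Hm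

    by-position : Tri (a < c) (a ≡ c) (c < a) → Response
    by-position (tri≈ _ a≡c _) =
      respond-with c′ (≤-forth (Similar-flip (toMark M u)) (<⇒≤ c<U))
        (subst (λ z → Similar H L z L′ c′) (sym a≡c) (Similar-weaken H≤2H-1 (toMark M l)))
        (subst (λ z → Similar H z U c′ U′) (sym a≡c) (Similar-weaken H≤2H-1 (Similar-flip (toMark M u))))
        (λ _ c<a → ⊥-elim (<⇒≢ c<a (sym a≡c))) (λ a<c _ → ⊥-elim (<⇒≢ a<c a≡c))
        (subst (λ z → Similar Hm z c c′ c′) (sym a≡c) Similar-diag)
    by-position (tri< a<c _ _)
      with split-marked-gap Hm (a ∸ L) (c ∸ a) 1≤Hm (gap-positive c<U U≡c+Y) (m<n⇒0<n∸m a<c)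
             (∸-split L≤a (<⇒≤ a<c) c≡L+X) X≈X′ᵀ Y≈Y′ᵀ X+Y≈X′+Y′
    ... | x′ , e′ , x′+e′≡X′ , _ , x≈x′ , e≈e′ , e+Y≈e′+Y′ =
      respond-with (L′ + x′) (≤-trans (m≤m+n (L′ + x′) (e′ + Y′)) (≤-reflexive (sym U′≡)))
        (Similar-+′ (a ∸ L) x′ (s≤s z≤n) (sym (m+[n∸m]≡n L≤a)) refl x≈x′)
        (Similar-weaken (n≤1+n H) SU⁺)
        (λ _ c<a → ⊥-elim (<⇒≱ a<c (<⇒≤ c<a)))
        (λ _ _ → SU⁺)
        (Similar-+′ (c ∸ a) e′ 1≤Hm (sym (m+[n∸m]≡n (<⇒≤ a<c))) c′≡ e≈e′)
      where
      c′≡ : c′ ≡ (L′ + x′) + e′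
      c′≡ = trans c′≡L′+X′ (trans (cong (L′ +_) (sym x′+e′≡X′)) (sym (+-assoc L′ x′ e′)))
      U≡ : U ≡ a + ((c ∸ a) + Y)
      U≡ = trans U≡c+Y (trans (cong (_+ Y) (sym (m+[n∸m]≡n (<⇒≤ a<c)))) (+-assoc a (c ∸ a) Y))
      U′≡ : U′ ≡ (L′ + x′) + (e′ + Y′)
      U′≡ = trans U′≡c′+Y′ (trans (cong (_+ Y′) c′≡) (+-assoc (L′ + x′) e′ Y′))
      SU⁺ : Similar (suc H) a U (L′ + x′) U′
      SU⁺ = Similar-+′ ((c ∸ a) + Y) (e′ + Y′) (s≤s z≤n) U≡ U′≡ e+Y≈e′+Y′
    by-position (tri> _ _ c<a)
      with split-marked-gap Hm (U ∸ a) (a ∸ c) 1≤Hm (gap-positive L<c c≡L+X) (m<n⇒0<n∸m c<a)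
             (trans (+-comm (U ∸ a) (a ∸ c)) (∸-split (<⇒≤ c<a) a≤U U≡c+Y)) Y≈Y′ᵀ X≈X′ᵀ
             (subst₂ (_≈⟨ suc (H + H) ⟩_) (+-comm X Y) (+-comm X′ Y′) X+Y≈X′+Y′)
    ... | y′ , e′ , y′+e′≡Y′ , _ , y≈y′ , e≈e′ , e+X≈e′+X′ =
      respond-with (c′ + e′) (≤-trans (m≤m+n (c′ + e′) y′) (≤-reflexive (sym U′≡)))
        (Similar-weaken (n≤1+n H) SL⁺) (Similar-+′ (U ∸ a) y′ (s≤s z≤n) (sym (m+[n∸m]≡n a≤U)) U′≡ y≈y′)
        (λ _ _ → SL⁺) (λ a<c _ → ⊥-elim (<⇒≱ a<c (<⇒≤ c<a)))
        (Similar-flip (Similar-+′ (a ∸ c) e′ 1≤Hm (sym (m+[n∸m]≡n (<⇒≤ c<a))) refl e≈e′))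
      where
      U′≡ : U′ ≡ (c′ + e′) + y′
      U′≡ = trans U′≡c′+Y′ (trans (cong (c′ +_) (trans (sym y′+e′≡Y′) (+-comm y′ e′))) (sym (+-assoc c′ e′ y′)))
      a≡ : a ≡ L + (X + (a ∸ c))
      a≡ = trans (sym (m+[n∸m]≡n (<⇒≤ c<a))) (trans (cong (_+ (a ∸ c)) c≡L+X) (+-assoc L X (a ∸ c)))
      a′≡ : c′ + e′ ≡ L′ + (X′ + e′)
      a′≡ = trans (cong (_+ e′) c′≡L′+X′) (+-assoc L′ X′ e′)
      SL⁺ : Similar (suc H) L a L′ (c′ + e′)
      SL⁺ = Similar-+′ (X + (a ∸ c)) (X′ + e′) (s≤s z≤n) a≡ a′≡
              (subst₂ (_≈⟨ suc H ⟩_) (+-comm (a ∸ c) X) (+-comm e′ X′) e+X≈e′+X′)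

  respond : Response
  respond with c ≤? L | U ≤? c
  ... | yes c≤L | _        = mark-before-gap c≤L
  ... | no  _   | yes U≤c  = mark-after-gap U≤c
  ... | no  c≰L | no  U≰c  = mark-in-gap (≰⇒> c≰L) (≰⇒> U≰c)

module RespondFinal {N : ℕ} {f f′ : Fin N → ℕ} {c c′ m : ℕ} (M : Matching 2 f f′ c c′)
                    (i₀ i₁ : Fin N) (fi₀≡0 : f i₀ ≡ 0) (fi₁≡m : f i₁ ≡ m) (f′≤m : ∀ i → f′ i ≤ m)
                    (a : ℕ) (a≤m : a ≤ m) where

  open Respond 1 ≤-refl M i₀ i₁ fi₀≡0 fi₁≡m f′≤m a a≤m

  Response : Set
  Response = ∃ λ a′ → a′ ≤ m × PartialIso (a ∷ f) (a′ ∷ f′) c c′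

  respond-with : ∀ a′ → a′ ≤ U′ → Similar 1 L a L′ a′ → Similar 1 a U a′ U′ →
                 (a ≡ c → a′ ≡ c′) → (a′ ≡ c′ → a ≡ c) → Response
  respond-with a′ a′≤U′ SL SU mark→ mark← = a′ , ≤-trans a′≤U′ (f′≤m u) , record
    { order-forth = order-forth′ ; order-back = order-back′ ; mark-forth = mark-forth′ ; mark-back = mark-back′ }
    where
    new : ∀ j → Similar 1 a (f j) a′ (f′ j)
    new = new-pairs a′ SL SU
    order-forth′ : ∀ i j → (a ∷ f) i ≤ (a ∷ f) j → (a′ ∷ f′) i ≤ (a′ ∷ f′) j
    order-forth′ zero    zero    _ = ≤-refl
    order-forth′ zero    (suc j)   = ≤-forth (new j)
    order-forth′ (suc i) zero      = ≥-forth (new i)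
    order-forth′ (suc i) (suc j)   = ≤-forth (pairs M i j)
    order-back′ : ∀ i j → (a′ ∷ f′) i ≤ (a′ ∷ f′) j → (a ∷ f) i ≤ (a ∷ f) j
    order-back′ zero    zero    _ = ≤-refl
    order-back′ zero    (suc j)   = ≤-back (new j)
    order-back′ (suc i) zero      = ≥-back (new i)
    order-back′ (suc i) (suc j)   = ≤-back (pairs M i j)
    mark-forth′ : ∀ i → (a ∷ f) i ≡ c → (a′ ∷ f′) i ≡ c′
    mark-forth′ zero    = mark→
    mark-forth′ (suc i) = Similar-≡ (toMark M i)
    mark-back′ : ∀ i → (a′ ∷ f′) i ≡ c′ → (a ∷ f) i ≡ c
    mark-back′ zero    = mark←
    mark-back′ (suc i) = Similar-≡ (Similar-sym (toMark M i))

  at-L : L ≡ a → Response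
  at-L L≡a = respond-with L′ (≤-forth (pairs M l u) L≤U)
    (subst (λ z → Similar 1 L z L′ L′) L≡a Similar-diag)
    (subst (λ z → Similar 1 z U L′ U′) L≡a (Similar-weaken (s≤s z≤n) (pairs M l u)))
    (λ a≡c → Similar-≡ (toMark M l) (trans L≡a a≡c)) (λ L′≡c′ → trans (sym L≡a) (Similar-≡ (Similar-sym (toMark M l)) L′≡c′))

  at-U : U ≡ a → Response
  at-U U≡a = respond-with U′ ≤-refl
    (subst (λ z → Similar 1 L z L′ U′) U≡a (Similar-weaken (s≤s z≤n) (pairs M l u)))
    (subst (λ z → Similar 1 z U U′ U′) U≡a Similar-diag)
    (λ a≡c → Similar-≡ (toMark M u) (trans U≡a a≡c)) (λ U′≡c′ → trans (sym U≡a) (Similar-≡ (Similar-sym (toMark M u)) U′≡c′))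

  at-mark : a ≡ c → Response
  at-mark a≡c = respond-with c′ (≤-forth (Similar-flip (toMark M u)) (subst (_≤ U) a≡c a≤U))
    (subst (λ z → Similar 1 L z L′ c′) (sym a≡c) (toMark M l))
    (subst (λ z → Similar 1 z U c′ U′) (sym a≡c) (Similar-flip (toMark M u)))
    (λ _ → refl) (λ _ → a≡c)

  L′+<U′ : ∀ d → suc d ≤ U′ ∸ L′ → L′ + d < U′
  L′+<U′ d d<gap′ = subst₂ _≤_ (+-suc L′ d) (m+[n∸m]≡n (≤-forth (pairs M l u) L≤U)) (+-monoʳ-≤ L′ d<gap′)

  2≤gap′ : L < a → a < U → 2 ≤ U′ ∸ L′
  2≤gap′ L<a a<U = ≈-≥ (gap-≤ (pairs M l u) L≤U) (m+n≤o⇒m≤o∸n 2 (≤-trans (s≤s L<a) a<U)) ≤-refl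

  answer-after-L : ∀ d → 1 ≤ d → L < a → a < U → L′ + d < U′ →
                   (a ≡ c → L′ + d ≡ c′) → (L′ + d ≡ c′ → a ≡ c) → Response
  answer-after-L d 1≤d L<a a<U a′<U′ = respond-with (L′ + d) (<⇒≤ a′<U′)
    (Similar-+′ (a ∸ L) d ≤-refl (sym (m+[n∸m]≡n L≤a)) refl (inj₂ (m<n⇒0<n∸m L<a , 1≤d)))
    (Similar-+′ (U ∸ a) (U′ ∸ (L′ + d)) ≤-refl (sym (m+[n∸m]≡n a≤U)) (sym (m+[n∸m]≡n (<⇒≤ a′<U′)))
       (inj₂ (m<n⇒0<n∸m a<U , m<n⇒0<n∸m a′<U′)))

  -- Answer L′ + 1, or L′ + 2 if that is the mark c′: then L < c < U, so the gap straddles the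
  -- mark and is at least 3 in both strings.
  strictly-inside : L < a → a < U → a ≢ c → Response
  strictly-inside L<a a<U a≢c with L′ + 1 ≟ c′
  ... | no L′+1≢c′ = answer-after-L 1 ≤-refl L<a a<U (L′+<U′ 1 (2≤gap′ L<a a<U)) (⊥-elim ∘ a≢c) (⊥-elim ∘ L′+1≢c′)
  ... | yes L′+1≡c′ = answer-after-L 2 (s≤s z≤n) L<a a<U (L′+<U′ 2 3≤gap′)
                        (⊥-elim ∘ a≢c) (λ L′+2≡c′ → ⊥-elim (1+n≢n (+-cancelˡ-≡ L′ 2 1 (trans L′+2≡c′ (sym L′+1≡c′)))))
    where
    L<c : L < c
    L<c = Similar-< (Similar-sym (toMark M l)) (subst (L′ <_) L′+1≡c′ (≤-reflexive (+-comm 1 L′)))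
    c<U : c < U
    c<U with U ≤? c
    ... | no  U≰c = ≰⇒> U≰c
    ... | yes U≤c = ⊥-elim (<⇒≱ (L′+<U′ 1 (2≤gap′ L<a a<U)) (subst (U′ ≤_) (sym L′+1≡c′) (≤-forth (toMark M u) U≤c)))
    3+L≤U : 3 + L ≤ U
    3+L≤U with <-cmp a c
    ... | tri< a<c _ _ = ≤-trans (s≤s (s≤s L<a)) (≤-trans (s≤s a<c) c<U)
    ... | tri≈ _ a≡c _ = ⊥-elim (a≢c a≡c)
    ... | tri> _ _ c<a = ≤-trans (s≤s (s≤s L<c)) (≤-trans (s≤s c<a) a<U)
    3≤gap′ : 3 ≤ U′ ∸ L′
    3≤gap′ = ≈-≥ (gap-≤ (across M l u L<c c<U) L≤U) (m+n≤o⇒m≤o∸n 3 3+L≤U) ≤-refl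

  respond : Response
  respond with a ≤? L | U ≤? a | a ≟ c
  ... | yes a≤L | _       | _       = at-L (≤-antisym L≤a a≤L)
  ... | no  _   | yes U≤a | _       = at-U (≤-antisym U≤a a≤U)
  ... | no  _   | no  _   | yes a≡c = at-mark a≡c
  ... | no  a≰L | no  U≰a | no  a≢c = strictly-inside (≰⇒> a≰L) (≰⇒> U≰a) a≢c

-- Pebble games on strings with a single 1

oneAt : ∀ m → ℕ → Vec Bool (suc m)
oneAt m c = tabulate (λ i → toℕ i ≡ᵇ c)

lookup-oneAt : ∀ {m} c (i : Fin (suc m)) → lookup (oneAt m c) i ≡ true ⇔ toℕ i ≡ c
lookup-oneAt c i = mk⇔
  (λ isOne → ≡ᵇ⇒≡ (toℕ i) c (from Bool.T-≡ (trans (sym (lookup∘tabulate (λ j → toℕ j ≡ᵇ c) i)) isOne)))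
  (λ i≡c → trans (lookup∘tabulate (λ j → toℕ j ≡ᵇ c) i) (to Bool.T-≡ (≡⇒≡ᵇ (toℕ i) c i≡c)))

-- The positions of the variables, then of min and max.
pebbles : Assignment m k → Fin (2 + k) → ℕ
pebbles {m = m} {k = zero}  ρ = 0 ∷ m ∷ []
pebbles         {k = suc k} ρ = toℕ (ρ zero) ∷ pebbles (ρ ∘ suc)

pebble : Term k → Fin (2 + k)
pebble {k = suc k} (var zero)    = zero
pebble {k = suc k} (var (suc i)) = suc (pebble (var i))
pebble {k = zero}  minT          = zero
pebble {k = suc k} minT          = suc (pebble {k = k} minT)
pebble {k = zero}  maxT          = suc zero
pebble {k = suc k} maxT          = suc (pebble {k = k} maxT)

pos-pebble : (ρ : Assignment m k) (t : Term k) → pos ρ t ≡ pebbles ρ (pebble t)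
pos-pebble {k = suc k} ρ (var zero)    = refl
pos-pebble {k = suc k} ρ (var (suc i)) = pos-pebble (ρ ∘ suc) (var i)
pos-pebble {k = zero}  ρ minT          = refl
pos-pebble {k = suc k} ρ minT          = pos-pebble (ρ ∘ suc) minT
pos-pebble {k = zero}  ρ maxT          = toℕ-fromℕ _
pos-pebble {k = suc k} ρ maxT          = pos-pebble (ρ ∘ suc) maxT

pebbles-≤ : (ρ : Assignment m k) (i : Fin (2 + k)) → pebbles ρ i ≤ m
pebbles-≤ {k = zero}  ρ zero          = z≤n
pebbles-≤ {k = zero}  ρ (suc zero)    = ≤-refl
pebbles-≤ {k = suc k} ρ zero          = toℕ≤pred[n] (ρ zero)
pebbles-≤ {k = suc k} ρ (suc i)       = pebbles-≤ (ρ ∘ suc) i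

Invariant : ℕ → ∀ {N} → (Fin N → ℕ) → (Fin N → ℕ) → ℕ → ℕ → Set
Invariant zero    = PartialIso
Invariant (suc r) = Matching (2 ^ suc r)

Invariant-sym : ∀ r {N} {f f′ : Fin N → ℕ} {c c′} → Invariant r f f′ c c′ → Invariant r f′ f c′ c
Invariant-sym zero    = PartialIso-sym
Invariant-sym (suc r) = Matching-sym

Invariant⇒PartialIso : ∀ r {N} {f f′ : Fin N → ℕ} {c c′} → Invariant r f f′ c c′ → PartialIso f f′ c c′
Invariant⇒PartialIso zero    = id
Invariant⇒PartialIso (suc r) = Matching⇒PartialIso

suc[2^r∸1]≡2^r : ∀ r → suc (2 ^ r ∸ 1) ≡ 2 ^ r
suc[2^r∸1]≡2^r r = trans (+-comm 1 _) (m∸n+n≡m (m^n>0 2 r))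

respond : ∀ r {N} {f f′ : Fin N → ℕ} {c c′ m} → Invariant (suc r) f f′ c c′ →
          (i₀ i₁ : Fin N) → f i₀ ≡ 0 → f i₁ ≡ m → (∀ i → f′ i ≤ m) →
          ∀ a → a ≤ m → ∃ λ a′ → a′ ≤ m × Invariant r (a ∷ f) (a′ ∷ f′) c c′
respond zero    M = RespondFinal.respond M
respond (suc r) {f = f} {f′} {c} {c′} M i₀ i₁ fi₀≡0 fi₁≡m f′≤m a a≤m =
  map₂ (λ {a′} → map₂ (subst (λ T → Matching T (a ∷ f) (a′ ∷ f′) c c′) 1+Hm≡H))
       (RespondMatching.respond Hm 1≤Hm (subst (λ T → Matching T f f′ c c′) 2H≡ M) i₀ i₁ fi₀≡0 fi₁≡m f′≤m a a≤m)
  where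
  H Hm : ℕ
  H  = 2 ^ suc r
  Hm = H ∸ 1
  2≤H : 2 ≤ H
  2≤H = *-monoʳ-≤ 2 (m^n>0 2 r)
  1+Hm≡H : suc Hm ≡ H
  1+Hm≡H = suc[2^r∸1]≡2^r (suc r)
  1≤Hm : 1 ≤ Hm
  1≤Hm = m+n≤o⇒m≤o∸n 1 2≤H
  2H≡ : 2 * H ≡ suc Hm + suc Hm
  2H≡ = trans (cong (H +_) (+-identityʳ H)) (cong₂ _+_ (sym 1+Hm≡H) (sym 1+Hm≡H))

Invariant-forth : ∀ r {c c′} (ρ ρ′ : Assignment m k) → Invariant (suc r) (pebbles ρ) (pebbles ρ′) c c′ →
                  ∀ a → ∃ λ a′ → Invariant r (pebbles (extend a ρ)) (pebbles (extend a′ ρ′)) c c′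
Invariant-forth {m} r {c} {c′} ρ ρ′ I a
  with respond r I (pebble minT) (pebble maxT) (sym (pos-pebble ρ minT))
         (trans (sym (pos-pebble ρ maxT)) (toℕ-fromℕ m)) (pebbles-≤ ρ′) (toℕ a) (toℕ≤pred[n] a)
... | a′ , a′≤m , I′ =
  fromℕ< (s≤s a′≤m) , subst (λ x → Invariant r (toℕ a ∷ pebbles ρ) (x ∷ pebbles ρ′) c c′) (sym (toℕ-fromℕ< (s≤s a′≤m))) I′

Invariant-back : ∀ r {c c′} (ρ ρ′ : Assignment m k) → Invariant (suc r) (pebbles ρ) (pebbles ρ′) c c′ →
                 ∀ a′ → ∃ λ a → Invariant r (pebbles (extend a ρ)) (pebbles (extend a′ ρ′)) c c′
Invariant-back r ρ ρ′ I a′ with Invariant-forth r ρ′ ρ (Invariant-sym (suc r) I) a′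
... | a , I′ = a , Invariant-sym r I′

module _ {c c′ : ℕ} (ρ ρ′ : Assignment m k) (P : PartialIso (pebbles ρ) (pebbles ρ′) c c′) where

  pos-≤-forth : ∀ t u → pos ρ t ≤ pos ρ u → pos ρ′ t ≤ pos ρ′ u
  pos-≤-forth t u t≤u = subst₂ _≤_ (sym (pos-pebble ρ′ t)) (sym (pos-pebble ρ′ u))
                          (order-forth P _ _ (subst₂ _≤_ (pos-pebble ρ t) (pos-pebble ρ u) t≤u))

  pos-mark-forth : ∀ t → pos ρ t ≡ c → pos ρ′ t ≡ c′
  pos-mark-forth t t≡c = trans (pos-pebble ρ′ t) (mark-forth P _ (trans (sym (pos-pebble ρ t)) t≡c))

Invariant-Sat : ∀ r {c c′} (φ : Formula k) (ρ ρ′ : Assignment m k) → quantifiers φ ≤ r →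
                Invariant r (pebbles ρ) (pebbles ρ′) c c′ → Sat (oneAt m c) ρ φ → Sat (oneAt m c′) ρ′ φ
Invariant-Sat r (t ≐ u) ρ ρ′ _ I t≡u = toℕ-injective (≤-antisym (forth t u (≤-reflexive (cong toℕ t≡u)))
                                                                (forth u t (≤-reflexive (cong toℕ (sym t≡u)))))
  where
  forth : ∀ t u → pos ρ t ≤ pos ρ u → pos ρ′ t ≤ pos ρ′ u
  forth = pos-≤-forth ρ ρ′ (Invariant⇒PartialIso r I)
Invariant-Sat r (t ≺ u) ρ ρ′ _ I t<u = ≰⇒> λ u≤t → <⇒≱ t<u (back u t u≤t)
  where
  back : ∀ t u → pos ρ′ t ≤ pos ρ′ u → pos ρ t ≤ pos ρ u
  back = pos-≤-forth ρ′ ρ (PartialIso-sym (Invariant⇒PartialIso r I))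
Invariant-Sat r (S t) ρ ρ′ _ I isOne =
  from (lookup-oneAt _ (evalT ρ′ t))
       (pos-mark-forth ρ ρ′ (Invariant⇒PartialIso r I) t (to (lookup-oneAt _ (evalT ρ t)) isOne))
Invariant-Sat r (~ φ) ρ ρ′ q I ¬sat sat′ = ¬sat (Invariant-Sat r φ ρ′ ρ q (Invariant-sym r I) sat′)
Invariant-Sat r (φ ∧′ ψ) ρ ρ′ q I (sat₁ , sat₂) =
  Invariant-Sat r φ ρ ρ′ (m+n≤o⇒m≤o _ q) I sat₁ , Invariant-Sat r ψ ρ ρ′ (m+n≤o⇒n≤o _ q) I sat₂
Invariant-Sat r (φ ∨′ ψ) ρ ρ′ q I (inj₁ sat) = inj₁ (Invariant-Sat r φ ρ ρ′ (m+n≤o⇒m≤o _ q) I sat)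
Invariant-Sat r (φ ∨′ ψ) ρ ρ′ q I (inj₂ sat) = inj₂ (Invariant-Sat r ψ ρ ρ′ (m+n≤o⇒n≤o _ q) I sat)
Invariant-Sat r (φ ⇒′ ψ) ρ ρ′ q I sat sat′ =
  Invariant-Sat r ψ ρ ρ′ (m+n≤o⇒n≤o _ q) I (sat (Invariant-Sat r φ ρ′ ρ (m+n≤o⇒m≤o _ q) (Invariant-sym r I) sat′))
Invariant-Sat (suc r) (∃′ φ) ρ ρ′ (s≤s q) I (a , sat) with Invariant-forth r ρ ρ′ I a
... | a′ , I′ = a′ , Invariant-Sat r φ (extend a ρ) (extend a′ ρ′) q I′ sat
Invariant-Sat (suc r) (∀′ φ) ρ ρ′ (s≤s q) I sat a′ with Invariant-back r ρ ρ′ I a′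
... | a , I′ = Invariant-Sat r φ (extend a ρ) (extend a′ ρ′) q I′ (sat a)

initial-Invariant : ∀ m r → 2 ^ suc r + 2 ^ suc r ≤ suc m →
  Invariant (suc r) (pebbles (noVars {suc m})) (pebbles (noVars {suc m})) (2 ^ suc r ∸ 1) (2 ^ suc r)
initial-Invariant m r 2T≤n = record
  { pairs = λ _ _ → Similar-refl ; across = λ _ _ _ _ → Similar-refl ; toMark = toMark′ }
  where
  T : ℕ
  T = 2 ^ suc r
  1≤T-1 : 1 ≤ T ∸ 1
  1≤T-1 = m+n≤o⇒m≤o∸n 1 (*-monoʳ-≤ 2 (m^n>0 2 r))
  T≤m : T ≤ m
  T≤m = ≤-pred (≤-trans (subst (_≤ T + T) (+-comm T 1) (+-monoʳ-≤ T (m^n>0 2 (suc r)))) 2T≤n)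
  T-1≤m∸T : T ∸ 1 ≤ m ∸ T
  T-1≤m∸T = m+n≤o⇒m≤o∸n (T ∸ 1) (≤-pred (subst (_≤ suc m) (cong (_+ T) (sym (suc[2^r∸1]≡2^r (suc r)))) 2T≤n))
  toMark′ : ∀ i → Similar (T ∸ 1) (pebbles (noVars {suc m}) i) (T ∸ 1) (pebbles (noVars {suc m}) i) T
  toMark′ zero       = Similar-+′ (T ∸ 1) T 1≤T-1 refl refl (inj₂ (≤-refl , m∸n≤m T 1))
  toMark′ (suc zero) = Similar-flip (Similar-+′ (m ∸ (T ∸ 1)) (m ∸ T) 1≤T-1
                         (sym (m+[n∸m]≡n (≤-trans (m∸n≤m T 1) T≤m))) (sym (m+[n∸m]≡n T≤m))
                         (inj₂ (≤-trans T-1≤m∸T (∸-monoʳ-≤ m (m∸n≤m T 1)) , T-1≤m∸T)))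

-- The lower bound

2^⌊log₂n⌋≤n : ∀ n → 1 ≤ n → 2 ^ ⌊log₂ n ⌋ ≤ n
2^⌊log₂n⌋≤n n = go ⌊log₂ n ⌋ n refl
  where
  go : ∀ k n → ⌊log₂ n ⌋ ≡ k → 1 ≤ n → 2 ^ k ≤ n
  go zero    n             _     1≤n = 1≤n
  go (suc k) (suc zero)    ()    _
  go (suc k) n@(suc (suc n′)) log≡ _ = begin
    2 * 2 ^ k     ≤⟨ *-monoʳ-≤ 2 (go k ⌊ n /2⌋ (trans (⌊log₂⌊n/2⌋⌋≡⌊log₂n⌋∸1 n) (cong (_∸ 1) log≡)) (s≤s z≤n)) ⟩
    2 * ⌊ n /2⌋   ≡⟨ cong (⌊ n /2⌋ +_) (+-identityʳ ⌊ n /2⌋) ⟩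
    ⌊ n /2⌋ + ⌊ n /2⌋ ≤⟨ +-monoʳ-≤ ⌊ n /2⌋ (⌊n/2⌋≤⌈n/2⌉ n) ⟩
    ⌊ n /2⌋ + ⌈ n /2⌉ ≡⟨ ⌊n/2⌋+⌈n/2⌉≡n n ⟩
    n             ∎
    where open ≤-Reasoning

indistinguishable : ∀ m r → 2 ^ suc r + 2 ^ suc r ≤ suc m → (φ : Sentence) → quantifiers φ ≤ suc r →
                    oneAt m (2 ^ suc r ∸ 1) ⊨ φ → oneAt m (2 ^ suc r) ⊨ φ
indistinguishable m r 2T≤n φ q = Invariant-Sat (suc r) φ noVars noVars q (initial-Invariant m r 2T≤n)

oneAt-≢ : ∀ {m c c′} → c ≤ m → c ≢ c′ → oneAt m c ≢ oneAt m c′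
oneAt-≢ {m} {c} {c′} c≤m c≢c′ same = c≢c′ (trans (sym (toℕ-fromℕ< (s≤s c≤m))) (to (lookup-oneAt c′ i) isOne′))
  where
  i : Fin (suc m)
  i = fromℕ< (s≤s c≤m)
  isOne′ : lookup (oneAt m c′) i ≡ true
  isOne′ = subst (λ v → lookup v i ≡ true) same (from (lookup-oneAt c i) (toℕ-fromℕ< (s≤s c≤m)))

lower-bound : Σ ℕ (λ N → (m : ℕ) → N ≤ suc m →
  Σ (Vec Bool (suc m)) (λ w → Σ (Vec Bool (suc m)) (λ w′ →
    (w ≢ w′) × ((φ : Sentence) → w ⊨ φ → ¬ (w′ ⊨ φ) → ⌊log₂ (suc m) ⌋ ≤ quantifiers φ))))
lower-bound = 4 , λ m 4≤n → strings m 4≤n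
  where
  strings : (m : ℕ) → 4 ≤ suc m → Σ (Vec Bool (suc m)) (λ w → Σ (Vec Bool (suc m)) (λ w′ →
    (w ≢ w′) × ((φ : Sentence) → w ⊨ φ → ¬ (w′ ⊨ φ) → ⌊log₂ (suc m) ⌋ ≤ quantifiers φ)))
  strings m 4≤n = oneAt m (T ∸ 1) , oneAt m T , oneAt-≢ T-1≤m T-1≢T , minimal
    where
    L r T : ℕ
    L = ⌊log₂ (suc m) ⌋
    r = L ∸ 2
    L≡2+r : L ≡ 2 + r
    L≡2+r = sym (trans (+-comm 2 r) (m∸n+n≡m (subst (_≤ L) (⌊log₂[2^n]⌋≡n 2) (⌊log₂⌋-mono-≤ 4≤n))))
    T = 2 ^ suc r
    2T≤n : T + T ≤ suc m
    2T≤n = subst (_≤ suc m) (cong (T +_) (+-identityʳ T))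
                 (subst (λ x → 2 ^ x ≤ suc m) L≡2+r (2^⌊log₂n⌋≤n (suc m) (s≤s z≤n)))
    T-1≤m : T ∸ 1 ≤ m
    T-1≤m = ≤-pred (≤-trans (≤-trans (≤-reflexive (suc[2^r∸1]≡2^r (suc r))) (m≤m+n T T)) 2T≤n)
    T-1≢T : T ∸ 1 ≢ T
    T-1≢T = <⇒≢ (≤-reflexive (suc[2^r∸1]≡2^r (suc r)))
    minimal : (φ : Sentence) → oneAt m (T ∸ 1) ⊨ φ → ¬ (oneAt m T ⊨ φ) → L ≤ quantifiers φ
    minimal φ sat ¬sat′ with L ≤? quantifiers φ
    ... | yes L≤q = L≤q
    ... | no  L≰q =
      ⊥-elim (¬sat′ (indistinguishable m r 2T≤n φ (≤-pred (subst (quantifiers φ <_) L≡2+r (≰⇒> L≰q))) sat))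

proposition5p1 :
  -- upper bound (n = suc m ≥ 1)
  ((m : ℕ) (w w′ : Vec Bool (suc m)) → w ≢ w′ →
    Σ Sentence (λ φ →
      (quantifiers φ ≤ ⌊log₂ (suc m) ⌋ + 6)
      × AlternatingPrenexEndingForall φ
      × (w ⊨ φ)
      × ¬ (w′ ⊨ φ)))
  ×
  -- lower bound: for all sufficiently large n = suc m
  Σ ℕ (λ N → (m : ℕ) → N ≤ suc m →
    Σ (Vec Bool (suc m)) (λ w → Σ (Vec Bool (suc m)) (λ w′ →
      (w ≢ w′)
      × ((φ : Sentence) → w ⊨ φ → ¬ (w′ ⊨ φ) →
           ⌊log₂ (suc m) ⌋ ≤ quantifiers φ))))
proposition5p1 = upper-bound , lower-bound
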